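{- Let $k\ge1$ and $G\in\mathcal{F}_{xy}^k$. If $G$ does not embed into $\mathbb{S}_k$, then $xy\notin E(G)$, $G$ is $xy$-alternating on $\mathbb{S}_{k+1}$, and $G$ is an obstruction for $\mathbb{S}_k$ (that is, $G$ does not embed in $\mathbb{S}_k$ but $G-e$ and $G/e$ embed in $\mathbb{S}_k$ for every edge $e$ of $G$).
   Context: All graphs are finite and simple. $\mathbb{S}_k$ denotes the orientable surface of genus $k$. A graph with terminals is a graph with two distinguished vertices $x,y$. $G$ is $xy$-alternating on $\mathbb{S}_k$ if its genus is $k$ and it has an embedding in $\mathbb{S}_k$ with a face walk $v_1\dots v_l$ and indices $i_1<i_2<i_3<i_4$ with $v_{i_1}=v_{i_3}=x$, $v_{i_2}=v_{i_4}=y$. $\mathcal{A}_{xy}^k$ is the class of graphs with terminals $x,y$ that embed in $\mathbb{S}_{k-1}$ or are $xy$-alternating on $\mathbb{S}_k$. Allowed minor operations on graphs with terminals: edge deletion and edge contraction, where contracting an edge joining the two terminals is forbidden and contracting an edge between a terminal and a non-terminal yields a terminal. $\mathcal{F}_{xy}^k$ is the set of graphs $G\notin\mathcal{A}_{xy}^k$ such that $G\ast e\in\mathcal{A}_{xy}^k$ for every edge $e$ and every allowed minor operation $\ast$. -}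

module Defs where

open import Data.Nat using (ℕ; zero; suc; _+_; _*_; _≤_; _<_; _<ᵇ_)
open import Data.Fin using (Fin; toℕ; punchIn; punchOut; _≟_)
open import Data.Bool using (Bool; true; false; _∧_; _∨_; not; if_then_else_; T)
open import Data.Bool.Properties using (∧-comm; ∨-comm)
open import Data.Product using (Σ; ∃; _×_; _,_; proj₁; proj₂)
open import Data.Sum using (_⊎_)
open import Data.Empty using (⊥-elim)
open import Relation.Nullary using (¬_; yes; no)
open import Relation.Nullary.Decidable using (⌊_⌋)
open import Relation.Binary.PropositionalEquality using (_≡_; _≢_; refl; sym; cong)

_==_ : ∀ {n} → Fin n → Fin n → Bool
a == b = ⌊ a ≟ b ⌋

==-refl : ∀ {n} (a : Fin n) → (a == a) ≡ true
==-refl a with a ≟ a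
... | yes _ = refl
... | no ne with ne refl
...   | ()

==-sym : ∀ {n} (a b : Fin n) → (a == b) ≡ (b == a)
==-sym a b with a ≟ b | b ≟ a
... | yes _ | yes _ = refl
... | no _ | no _ = refl
... | yes p | no q = ⊥-elim (q (sym p))
... | no p | yes q = ⊥-elim (p (sym q))

count : (n : ℕ) → (Fin n → Bool) → ℕ
count zero f = 0
count (suc n) f = (if f Fin.zero then 1 else 0) + count n (λ i → f (Fin.suc i))

sumF : (n : ℕ) → (Fin n → ℕ) → ℕ
sumF zero f = 0
sumF (suc n) f = f Fin.zero + sumF n (λ i → f (Fin.suc i))

anyF : (n : ℕ) → (Fin n → Bool) → Bool
anyF zero f = false
anyF (suc n) f = f Fin.zero ∨ anyF n (λ i → f (Fin.suc i))

anyBelow : ℕ → (ℕ → Bool) → Bool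
anyBelow zero f = false
anyBelow (suc m) f = anyBelow m f ∨ f m

iter : ∀ {A : Set} → ℕ → (A → A) → A → A
iter zero f a = a
iter (suc j) f a = f (iter j f a)

record Graph : Set where
  field
    n        : ℕ
    adj      : Fin n → Fin n → Bool
    adj-sym  : ∀ u v → adj u v ≡ adj v u
    adj-irr  : ∀ u → adj u u ≡ false
open Graph public

mkGraph : (m : ℕ) → (Fin m → Fin m → Bool) → Graph
mkGraph m r = record
  { n = m
  ; adj = λ a b → not (a == b) ∧ (r a b ∨ r b a)
  ; adj-sym = λ a b → helper a b
  ; adj-irr = λ a → irr a }
  where
  helper : ∀ a b → (not (a == b) ∧ (r a b ∨ r b a)) ≡ (not (b == a) ∧ (r b a ∨ r a b))
  helper a b rewrite ==-sym a b | ∨-comm (r a b) (r b a) = refl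
  irr : ∀ a → (not (a == a) ∧ (r a a ∨ r a a)) ≡ false
  irr a rewrite ==-refl a = refl

Edge : (G : Graph) → Fin (n G) → Fin (n G) → Set
Edge G u v = T (adj G u v)

deleteEdge : (G : Graph) → Fin (n G) → Fin (n G) → Graph
deleteEdge G u v = mkGraph (n G) (λ a b → adj G a b ∧ not ((a == u) ∧ (b == v) ∨ (a == v) ∧ (b == u)))

-- G / uv : contract the edge uv, merging v into u (v is removed; the
-- remaining vertices are renumbered by punchIn v; loops and parallel
-- edges are discarded)
contract′ : (m : ℕ) → (Fin m → Fin m → Bool) → (u v : Fin m) → u ≢ v → Graph
contract′ zero r () v ne
contract′ (suc m) r u v ne =
  mkGraph m (λ a b → r (punchIn v a) (punchIn v b)
                      ∨ ((punchIn v a == u) ∧ r v (punchIn v b)))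

contractEdge : (G : Graph) → (u v : Fin (n G)) → u ≢ v → Graph
contractEdge G = contract′ (n G) (adj G)

record TGraph : Set where
  field
    graph : Graph
    x y   : Fin (n graph)
open TGraph public

-- where a vertex w goes when v is merged into u
mergeImg : (m : ℕ) → (u v : Fin (suc m)) → u ≢ v → Fin (suc m) → Fin m
mergeImg m u v ne w with v ≟ w
... | yes _ = punchOut {i = v} {j = u} (λ e → ne (sym e))
... | no v≢w = punchOut v≢w

tcontract′ : (m : ℕ) → (r : Fin m → Fin m → Bool) → (u v : Fin m) → (ne : u ≢ v)
           → (x y : Fin m) → TGraph
tcontract′ zero r () v ne x y
tcontract′ (suc m) r u v ne x y = record
  { graph = contract′ (suc m) r u v ne
  ; x = mergeImg m u v ne x
  ; y = mergeImg m u v ne y }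

tdelete : (T′ : TGraph) → Fin (n (graph T′)) → Fin (n (graph T′)) → TGraph
tdelete T′ u v = record { graph = deleteEdge (graph T′) u v ; x = x T′ ; y = y T′ }

tcontract : (T′ : TGraph) → (u v : Fin (n (graph T′))) → u ≢ v → TGraph
tcontract T′ u v ne = tcontract′ (n (graph T′)) (adj (graph T′)) u v ne (x T′) (y T′)

-- Embeddings in orientable surfaces, via rotation systems
-- (Heffter–Edmonds).  A rotation system gives at every vertex u a cyclic
-- permutation ρ u of the neighbourhood of u.

module _ (G : Graph) where

  record Rotation : Set where
    field
      ρ       : Fin (n G) → Fin (n G) → Fin (n G)
      ρ-nbr   : ∀ u v → Edge G u v → Edge G u (ρ u v)
      ρ-inj   : ∀ u v w → Edge G u v → Edge G u w → ρ u v ≡ ρ u w → v ≡ w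
      ρ-cyc   : ∀ u v w → Edge G u v → Edge G u w → ∃ λ j → iter j (ρ u) v ≡ w

  Dart : Set
  Dart = Fin (n G) × Fin (n G)

  faceMap : Rotation → Dart → Dart
  faceMap R (u , v) = v , Rotation.ρ R v u

  dartLt : Dart → Dart → Bool
  dartLt (a , b) (c , d) = (toℕ a <ᵇ toℕ c) ∨ ((a == c) ∧ (toℕ b <ᵇ toℕ d))

  -- a dart is the representative of its face if it is the least dart in
  -- its face orbit (orbits have length < n*n)
  faceRep : Rotation → Dart → Bool
  faceRep R d = adj G (proj₁ d) (proj₂ d)
              ∧ not (anyBelow (n G * n G) (λ j → dartLt (iter j (faceMap R) d) d))

  dartFaces : Rotation → ℕ
  dartFaces R = sumF (n G) (λ u → count (n G) (λ v → faceRep R (u , v)))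

  isolated : ℕ
  isolated = count (n G) (λ u → not (anyF (n G) (λ v → adj G u v)))

  -- total number of faces (each isolated vertex contributes its own face)
  faces : Rotation → ℕ
  faces R = dartFaces R + isolated

  edges : ℕ
  edges = sumF (n G) (λ u → count (n G) (λ v → (toℕ u <ᵇ toℕ v) ∧ adj G u v))

  reach : ℕ → Fin (n G) → Fin (n G) → Bool
  reach zero u v = u == v
  reach (suc t) u v = reach t u v ∨ anyF (n G) (λ w → reach t u w ∧ adj G w v)

  connected : Fin (n G) → Fin (n G) → Bool
  connected = reach (n G)

  -- number of connected components (count least vertices of components)
  components : ℕ
  components = count (n G) (λ u → not (anyF (n G) (λ w → (toℕ w <ᵇ toℕ u) ∧ connected w u)))

  -- the rotation system R has (total) genus ≤ k, i.e. by Euler's formula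
  -- summed over components  2g = 2c - V + E - F ≤ 2k
  GenusLe : Rotation → ℕ → Set
  GenusLe R k = 2 * components + edges ≤ 2 * k + n G + faces R

  EmbedsIn : ℕ → Set
  EmbedsIn k = Σ Rotation λ R → GenusLe R k

  HasGenus : ℕ → Set
  HasGenus k = EmbedsIn k × (∀ j → j < k → ¬ EmbedsIn j)

  -- the face walk starting at dart d has vertex sequence
  -- v_i = tail of faceMap^i d, for 0 ≤ i < l, where l is the length of the face
  FaceAlternates : Rotation → Fin (n G) → Fin (n G) → Set
  FaceAlternates R x y =
    Σ Dart λ d → Edge G (proj₁ d) (proj₂ d) ×
    Σ ℕ λ l → 0 < l × iter l (faceMap R) d ≡ d
      × (∀ j → 0 < j → j < l → iter j (faceMap R) d ≢ d)
      × Σ ℕ λ i₁ → Σ ℕ λ i₂ → Σ ℕ λ i₃ → Σ ℕ λ i₄ →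
          i₁ < i₂ × i₂ < i₃ × i₃ < i₄ × i₄ < l
          × proj₁ (iter i₁ (faceMap R) d) ≡ x
          × proj₁ (iter i₂ (faceMap R) d) ≡ y
          × proj₁ (iter i₃ (faceMap R) d) ≡ x
          × proj₁ (iter i₄ (faceMap R) d) ≡ y

Obstruction : Graph → ℕ → Set
Obstruction G k = ¬ EmbedsIn G k
  × (∀ u v → Edge G u v → EmbedsIn (deleteEdge G u v) k)
  × (∀ u v → Edge G u v → (ne : u ≢ v) → EmbedsIn (contractEdge G u v ne) k)

Alternating : TGraph → ℕ → Set
Alternating T′ k = HasGenus (graph T′) k
  × Σ (Rotation (graph T′)) λ R → GenusLe (graph T′) R k
      × FaceAlternates (graph T′) R (x T′) (y T′)

-- the class 𝒜^k_xy  (S_{-1} is empty, so for k = 0 only the second option)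
𝒜 : TGraph → ℕ → Set
𝒜 T′ zero = Alternating T′ zero
𝒜 T′ (suc j) = EmbedsIn (graph T′) j ⊎ Alternating T′ (suc j)

JoinsTerminals : (T′ : TGraph) → Fin (n (graph T′)) → Fin (n (graph T′)) → Set
JoinsTerminals T′ u v = (u ≡ x T′ × v ≡ y T′) ⊎ (u ≡ y T′ × v ≡ x T′)

ℱ : TGraph → ℕ → Set
ℱ T′ k = ¬ 𝒜 T′ k
  × (∀ u v → Edge (graph T′) u v → 𝒜 (tdelete T′ u v) k)
  × (∀ u v → Edge (graph T′) u v → ¬ JoinsTerminals T′ u v
       → (ne : u ≢ v) → 𝒜 (tcontract T′ u v ne) k)

{-# OPTIONS --safe #-}
-- Embeddings are rotation systems, with genus measured by Euler's formula.  Inserting an edge uw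
-- of G into a rotation system of G − uw, right after a corner at u and a corner at w, raises the
-- genus by at most one, and not at all when the two corners lie on a common face (that face is
-- split in two).  As G does not embed in S_k, no G − e embeds in S_{k−1}, so every G − e is
-- xy-alternating on S_k.  If xy were an edge, x and y would lie on a common face of G − xy and
-- G would embed in S_k.  For an edge xz, the vertex z cannot occur on the alternating face of
-- G − xz for the same reason, so inserting xz at the corner of that face at x only lengthens the
-- face past its x,y,x,y pattern: G is xy-alternating on S_{k+1}.  Finally every minor of G
-- lies in 𝒜^k and hence embeds in S_k, so G is an obstruction.
module Submission where

open import Defs
open import Data.Nat using (ℕ; zero; suc; pred; >-nonZero; _+_; _*_; _∸_; _≤_; _<_; _<ᵇ_; z≤n; s≤s; _%_; _/_)
open import Data.Nat.Properties hiding (_≟_; suc-injective)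
open import Data.Nat.DivMod using (m≡m%n+[m/n]*n; m%n<n)
open import Data.Nat.Tactic.RingSolver using (solve-∀)
open import Data.Fin using (Fin; toℕ; _≟_; combine) renaming (zero to fz; suc to fs)
open import Data.Fin.Properties using (toℕ-injective; toℕ<n; suc-injective; pigeonhole; combine-injectiveˡ; combine-injectiveʳ)
open import Data.Bool using (Bool; true; false; _∧_; _∨_; not; if_then_else_; T)
open import Data.Bool.Properties using (T-≡; T-∧; T-∨)
open import Data.Product using (Σ; ∃; _×_; _,_; proj₁; proj₂)
open import Data.Sum using (_⊎_; inj₁; inj₂)
open import Data.Empty using (⊥; ⊥-elim)
open import Data.Unit using (tt)
open import Relation.Nullary using (¬_; yes; no)
open import Relation.Binary.PropositionalEquality
open import Function.Bundles using (Equivalence)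

T⇒≡true : ∀ {b} → T b → b ≡ true
T⇒≡true = Equivalence.to T-≡

≡true⇒T : ∀ {b} → b ≡ true → T b
≡true⇒T = Equivalence.from T-≡

¬T⇒≡false : ∀ {b} → ¬ T b → b ≡ false
¬T⇒≡false {true} h = ⊥-elim (h tt)
¬T⇒≡false {false} _ = refl

T-∧ˡ : ∀ {a b} → T (a ∧ b) → T a
T-∧ˡ {a} {b} t = proj₁ (Equivalence.to (T-∧ {a} {b}) t)

T-∧ʳ : ∀ {a b} → T (a ∧ b) → T b
T-∧ʳ {a} {b} t = proj₂ (Equivalence.to (T-∧ {a} {b}) t)

T-∧-intro : ∀ {a b} → T a → T b → T (a ∧ b)
T-∧-intro {a} {b} s t = Equivalence.from (T-∧ {a} {b}) (s , t)

T-∨-elim : ∀ {a b} → T (a ∨ b) → T a ⊎ T b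
T-∨-elim {a} {b} = Equivalence.to (T-∨ {a} {b})

T-∨ˡ : ∀ {a b} → T a → T (a ∨ b)
T-∨ˡ {a} {b} t = Equivalence.from (T-∨ {a} {b}) (inj₁ t)

T-∨ʳ : ∀ {a b} → T b → T (a ∨ b)
T-∨ʳ {a} {b} t = Equivalence.from (T-∨ {a} {b}) (inj₂ t)

T-not-intro : ∀ {a} → ¬ T a → T (not a)
T-not-intro {true} h = h tt
T-not-intro {false} _ = tt

T-not-elim : ∀ {a} → T (not a) → ¬ T a
T-not-elim {true} () _
T-not-elim {false} _ ()

==⇒≡ : ∀ {n} {a b : Fin n} → T (a == b) → a ≡ b
==⇒≡ {a = a} {b} h with a ≟ b
... | yes e = e
... | no _ = ⊥-elim h

≡⇒== : ∀ {n} {a b : Fin n} → a ≡ b → T (a == b)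
≡⇒== {a = a} {b} e with a ≟ b
... | yes _ = tt
... | no ne = ne e

≢⇒==false : ∀ {n} {a b : Fin n} → a ≢ b → (a == b) ≡ false
≢⇒==false {a = a} {b} ne with a ≟ b
... | yes e = ⊥-elim (ne e)
... | no _ = refl

iter-add : ∀ {A : Set} (f : A → A) a b z → iter (a + b) f z ≡ iter a f (iter b f z)
iter-add f zero b z = refl
iter-add f (suc a) b z = cong f (iter-add f a b z)

iter-suc : ∀ {A : Set} (f : A → A) j z → iter (suc j) f z ≡ iter j f (f z)
iter-suc f j z = trans (cong (λ k → iter k f z) (+-comm 1 j)) (iter-add f j 1 z)

iter-comm : ∀ {A : Set} (f : A → A) a b z → iter a f (iter b f z) ≡ iter b f (iter a f z)
iter-comm f a b z = begin
  iter a f (iter b f z) ≡⟨ iter-add f a b z ⟨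
  iter (a + b) f z      ≡⟨ cong (λ k → iter k f z) (+-comm a b) ⟩
  iter (b + a) f z      ≡⟨ iter-add f b a z ⟩
  iter b f (iter a f z) ∎
  where open ≡-Reasoning

iter-pred : ∀ {A : Set} (f : A → A) m → 0 < m → ∀ z → f (iter (pred m) f z) ≡ iter m f z
iter-pred f m 0<m z = cong (λ k → iter k f z) (suc-pred m {{>-nonZero 0<m}})

iter-cong : ∀ {A : Set} (f g : A → A) → (∀ z → f z ≡ g z) → ∀ j z → iter j f z ≡ iter j g z
iter-cong f g e zero z = refl
iter-cong f g e (suc j) z = trans (e _) (cong g (iter-cong f g e j z))

iter-mul : ∀ {A : Set} (f : A → A) P z → iter P f z ≡ z → ∀ q → iter (q * P) f z ≡ z
iter-mul f P z e zero = refl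
iter-mul f P z e (suc q) = trans (iter-add f P (q * P) z) (trans (cong (iter P f) (iter-mul f P z e q)) e)

count-mono : ∀ n (f g : Fin n → Bool) → (∀ i → T (f i) → T (g i)) → count n f ≤ count n g
count-mono zero f g h = z≤n
count-mono (suc n) f g h with f fz in ef | g fz in eg
... | true | true = s≤s (count-mono n _ _ (λ i → h (fs i)))
... | false | true = ≤-trans (count-mono n _ _ (λ i → h (fs i))) (n≤1+n _)
... | false | false = count-mono n _ _ (λ i → h (fs i))
... | true | false with h fz (≡true⇒T ef)
... | t rewrite eg = ⊥-elim t

count-∨ : ∀ n (f g : Fin n → Bool) → count n (λ i → f i ∨ g i) ≤ count n f + count n g
count-∨ zero f g = z≤n
count-∨ (suc n) f g with f fz | g fz
... | true | true = s≤s (≤-trans (count-∨ n _ _) (+-monoʳ-≤ (count n (λ i → f (fs i))) (n≤1+n _)))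
... | true | false = s≤s (count-∨ n _ _)
... | false | true = ≤-trans (s≤s (count-∨ n _ _)) (≤-reflexive (sym (+-suc _ _)))
... | false | false = count-∨ n _ _

count-split : ∀ n (f g : Fin n → Bool) → count n f ≡ count n (λ i → f i ∧ g i) + count n (λ i → f i ∧ not (g i))
count-split zero f g = refl
count-split (suc n) f g with f fz | g fz
... | true | true = cong suc (count-split n _ _)
... | true | false = trans (cong suc (count-split n _ _)) (sym (+-suc _ _))
... | false | _ = count-split n _ _

T⇒count-pos : ∀ n (f : Fin n → Bool) i → T (f i) → 1 ≤ count n f
T⇒count-pos (suc n) f fz h with f fz
... | true = s≤s z≤n
T⇒count-pos (suc n) f (fs i) h with f fz
... | true = s≤s z≤n
... | false = T⇒count-pos n _ i h

count-≥2 : ∀ n (f : Fin n → Bool) i j → i ≢ j → T (f i) → T (f j) → 2 ≤ count n f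
count-≥2 (suc n) f fz fz ne _ _ = ⊥-elim (ne refl)
count-≥2 (suc n) f fz (fs j) ne hi hj with f fz
... | true = s≤s (T⇒count-pos n _ j hj)
count-≥2 (suc n) f (fs i) fz ne hi hj with f fz
... | true = s≤s (T⇒count-pos n _ i hi)
count-≥2 (suc n) f (fs i) (fs j) ne hi hj with f fz
... | true = s≤s (≤-trans (s≤s z≤n) (T⇒count-pos n _ i hi))
... | false = count-≥2 n _ i j (λ e → ne (cong fs e)) hi hj

count-≡0 : ∀ n (f : Fin n → Bool) → (∀ i → ¬ T (f i)) → count n f ≡ 0
count-≡0 zero f h = refl
count-≡0 (suc n) f h with f fz in e
... | true = ⊥-elim (h fz (≡true⇒T e))
... | false = count-≡0 n _ (λ i → h (fs i))

count-≡n : ∀ n (f : Fin n → Bool) → (∀ i → T (f i)) → count n f ≡ n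
count-≡n zero f h = refl
count-≡n (suc n) f h with f fz in e
... | true = cong suc (count-≡n n _ (λ i → h (fs i)))
... | false = ⊥-elim (subst T e (h fz))

count-≤n : ∀ n (f : Fin n → Bool) → count n f ≤ n
count-≤n zero f = z≤n
count-≤n (suc n) f with f fz
... | true = s≤s (count-≤n n _)
... | false = ≤-trans (count-≤n n _) (n≤1+n n)

count-≤1 : ∀ n (f : Fin n → Bool) → (∀ i j → T (f i) → T (f j) → i ≡ j) → count n f ≤ 1
count-≤1 zero f h = z≤n
count-≤1 (suc n) f h with f fz in e
... | true = s≤s (≤-reflexive (count-≡0 n _ (λ i t → fz≢fs (h fz (fs i) (≡true⇒T e) t))))
  where fz≢fs : ∀ {m} {i : Fin m} → fz ≡ fs i → ⊥
        fz≢fs ()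
... | false = count-≤1 n _ (λ i j a b → suc-injective (h (fs i) (fs j) a b))

count-pos⇒∃ : ∀ n (f : Fin n → Bool) → 1 ≤ count n f → ∃ λ i → T (f i)
count-pos⇒∃ (suc n) f h with f fz in e
... | true = fz , ≡true⇒T e
... | false with count-pos⇒∃ n _ h
... | i , t = fs i , t

sumF-mono : ∀ n (f g : Fin n → ℕ) → (∀ a → f a ≤ g a) → sumF n f ≤ sumF n g
sumF-mono zero f g h = z≤n
sumF-mono (suc n) f g h = +-mono-≤ (h fz) (sumF-mono n _ _ (λ a → h (fs a)))

sumF-+ : ∀ n (f g : Fin n → ℕ) → sumF n (λ a → f a + g a) ≡ sumF n f + sumF n g
sumF-+ zero f g = refl
sumF-+ (suc n) f g rewrite sumF-+ n (λ a → f (fs a)) (λ a → g (fs a)) =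
  interchange (f fz) (g fz) (sumF n (λ a → f (fs a))) (sumF n (λ a → g (fs a)))
  where
  interchange : ∀ a b c d → a + b + (c + d) ≡ a + c + (b + d)
  interchange = solve-∀

sumF-≥term : ∀ n (f : Fin n → ℕ) a → f a ≤ sumF n f
sumF-≥term (suc n) f fz = m≤m+n _ _
sumF-≥term (suc n) f (fs a) = ≤-trans (sumF-≥term n _ a) (m≤n+m _ _)

sumF-≥two-terms : ∀ n (f : Fin n → ℕ) a b → a ≢ b → f a + f b ≤ sumF n f
sumF-≥two-terms (suc n) f fz fz ne = ⊥-elim (ne refl)
sumF-≥two-terms (suc n) f fz (fs b) ne = +-monoʳ-≤ (f fz) (sumF-≥term n _ b)
sumF-≥two-terms (suc n) f (fs a) fz ne = ≤-trans (≤-reflexive (+-comm (f (fs a)) (f fz))) (+-monoʳ-≤ (f fz) (sumF-≥term n _ a))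
sumF-≥two-terms (suc n) f (fs a) (fs b) ne = ≤-trans (sumF-≥two-terms n _ a b (λ e → ne (cong fs e))) (m≤n+m _ _)

sumF-zero : ∀ n (f : Fin n → ℕ) → (∀ a → f a ≡ 0) → sumF n f ≡ 0
sumF-zero zero f h = refl
sumF-zero (suc n) f h rewrite h fz = sumF-zero n _ (λ a → h (fs a))

sumF-cong : ∀ n (f g : Fin n → ℕ) → (∀ a → f a ≡ g a) → sumF n f ≡ sumF n g
sumF-cong zero f g h = refl
sumF-cong (suc n) f g h = cong₂ _+_ (h fz) (sumF-cong n _ _ (λ a → h (fs a)))

module PairCount (n : ℕ) where
  D : Set
  D = Fin n × Fin n

  countPairs : (D → Bool) → ℕ
  countPairs P = sumF n (λ a → count n (λ b → P (a , b)))

  countPairs-mono : (P Q : D → Bool) → (∀ d → T (P d) → T (Q d)) → countPairs P ≤ countPairs Q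
  countPairs-mono P Q h = sumF-mono n _ _ (λ a → count-mono n _ _ (λ b → h (a , b)))

  countPairs-∨ : (P Q : D → Bool) → countPairs (λ d → P d ∨ Q d) ≤ countPairs P + countPairs Q
  countPairs-∨ P Q = ≤-trans (sumF-mono n _ _ (λ a → count-∨ n _ _)) (≤-reflexive (sumF-+ n _ _))

  countPairs-split : (P Q : D → Bool) → countPairs P ≡ countPairs (λ d → P d ∧ Q d) + countPairs (λ d → P d ∧ not (Q d))
  countPairs-split P Q = trans (sumF-cong n _ _ (λ a → count-split n _ _)) (sumF-+ n _ _)

  T⇒countPairs-pos : (P : D → Bool) (d : D) → T (P d) → 1 ≤ countPairs P
  T⇒countPairs-pos P (a , b) t = ≤-trans (T⇒count-pos n _ b t) (sumF-≥term n (λ a → count n (λ b → P (a , b))) a)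

  countPairs-≥2 : (P : D → Bool) (d e : D) → d ≢ e → T (P d) → T (P e) → 2 ≤ countPairs P
  countPairs-≥2 P (a , b) (c , d) ne tp tq with a ≟ c
  ... | yes refl = ≤-trans (count-≥2 n _ b d (λ e → ne (cong (a ,_) e)) tp tq) (sumF-≥term n (λ a → count n (λ b → P (a , b))) a)
  ... | no a≢c = ≤-trans (+-mono-≤ (T⇒count-pos n _ b tp) (T⇒count-pos n _ d tq)) (sumF-≥two-terms n (λ a → count n (λ b → P (a , b))) a c a≢c)

  countPairs-≤1 : (P : D → Bool) → (∀ (d e : D) → T (P d) → T (P e) → d ≡ e) → countPairs P ≤ 1
  countPairs-≤1 P h = go n (λ a b → P (a , b)) (λ a b c d t1 t2 → h (a , b) (c , d) t1 t2)
    where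
    go : ∀ m (Q : Fin m → Fin n → Bool) → (∀ a b c d → T (Q a b) → T (Q c d) → (a , b) ≡ (c , d)) → sumF m (λ a → count n (Q a)) ≤ 1
    go zero Q h = z≤n
    go (suc m) Q h with count n (Q fz) in e
    ... | zero = go m (λ a → Q (fs a)) (λ a b c d t1 t2 → cong₂ _,_ (suc-injective (cong proj₁ (h (fs a) b (fs c) d t1 t2))) (cong proj₂ (h (fs a) b (fs c) d t1 t2)))
    ... | suc k with count-pos⇒∃ n (Q fz) (subst (1 ≤_) (sym e) (s≤s z≤n))
    ... | b , tb = ≤-trans (+-monoʳ-≤ (suc k) (≤-reflexive (sumF-zero m _ (λ a → count-≡0 n _ (λ c tc → fs≢fz (cong proj₁ (h _ _ _ _ tc tb)))))))
                   (≤-trans (≤-reflexive (+-identityʳ (suc k))) (subst (_≤ 1) e (count-≤1 n (Q fz) (λ i j ti tj → cong proj₂ (h fz i fz j ti tj)))))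
      where fs≢fz : ∀ {a : Fin m} → fs a ≡ fz → ⊥
            fs≢fz ()

  countPairs-≡0 : (P : D → Bool) → (∀ d → ¬ T (P d)) → countPairs P ≡ 0
  countPairs-≡0 P h = sumF-zero n _ (λ a → count-≡0 n _ (λ b → h (a , b)))

T-case : ∀ {X : Set} (b : Bool) → (T b → X) → (¬ T b → X) → X
T-case true y n = y tt
T-case false y n = n (λ ())

≟-case : ∀ {n} {X : Set} (a b : Fin n) → (a ≡ b → X) → (a ≢ b → X) → X
≟-case a b y n with a ≟ b
... | yes e = y e
... | no ne = n ne

¬anyBelow⇒¬T : ∀ m (g : ℕ → Bool) → T (not (anyBelow m g)) → ∀ j → j < m → ¬ T (g j)
¬anyBelow⇒¬T (suc m) g h j j<m t with anyBelow m g in e | g m in e2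
¬anyBelow⇒¬T (suc m) g () j j<m t | true | _
¬anyBelow⇒¬T (suc m) g () j j<m t | false | true
... | false | false with m≤n⇒m<n∨m≡n (≤-pred j<m)
... | inj₁ lt = ¬anyBelow⇒¬T m g (subst (λ b → T (not b)) (sym e) tt) j lt t
... | inj₂ refl = subst T e2 t

anyBelow⇒∃ : ∀ m (g : ℕ → Bool) → T (anyBelow m g) → ∃ λ j → j < m × T (g j)
anyBelow⇒∃ (suc m) g h with T-∨-elim {anyBelow m g} h
... | inj₁ t = let (j , lt , tj) = anyBelow⇒∃ m g t in j , m<n⇒m<1+n lt , tj
... | inj₂ t = m , ≤-refl , t

∀¬T⇒¬anyBelow : ∀ m (g : ℕ → Bool) → (∀ j → j < m → ¬ T (g j)) → T (not (anyBelow m g))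
∀¬T⇒¬anyBelow m g h = T-not-intro (λ t → let (j , lt , tj) = anyBelow⇒∃ m g t in h j lt tj)

_==ᴰ_ : ∀ {n} → Fin n × Fin n → Fin n × Fin n → Bool
(a , b) ==ᴰ (c , d) = (a == c) ∧ (b == d)

==ᴰ⇒≡ : ∀ {n} (d e : Fin n × Fin n) → T (d ==ᴰ e) → d ≡ e
==ᴰ⇒≡ (a , b) (c , d) t = cong₂ _,_ (==⇒≡ (T-∧ˡ t)) (==⇒≡ (T-∧ʳ {a == c} t))

≡⇒==ᴰ : ∀ {n} (d e : Fin n × Fin n) → d ≡ e → T (d ==ᴰ e)
≡⇒==ᴰ (a , b) (c , d) refl = T-∧-intro {a == a} (≡⇒== refl) (≡⇒== refl)

≟ᴰ-case : ∀ {n} {X : Set} (d e : Fin n × Fin n) → (d ≡ e → X) → (d ≢ e → X) → X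
≟ᴰ-case d e y n = T-case (d ==ᴰ e) (λ t → y (==ᴰ⇒≡ d e t)) (λ h → n (λ eq → h (≡⇒==ᴰ d e eq)))

T⇒anyBelow : ∀ m (g : ℕ → Bool) j → j < m → T (g j) → T (anyBelow m g)
T⇒anyBelow (suc m) g j j<m t with m≤n⇒m<n∨m≡n (≤-pred j<m)
... | inj₁ lt = T-∨ˡ (T⇒anyBelow m g j lt t)
... | inj₂ refl = T-∨ʳ {anyBelow j g} t

minimal-witness : ∀ (g : ℕ → Bool) t0 → T (g t0) → ∃ λ t → T (g t) × (∀ t' → t' < t → ¬ T (g t'))
minimal-witness g t0 h = go (suc t0) t0 ≤-refl h
  where
  go : ∀ fuel t0 → t0 < fuel → T (g t0) → ∃ λ t → T (g t) × (∀ t' → t' < t → ¬ T (g t'))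
  go (suc fuel) t0 lt h = T-case (anyBelow t0 g)
    (λ a → let (j , j<t0 , tj) = anyBelow⇒∃ t0 g a in go fuel j (<-≤-trans j<t0 (≤-pred lt)) tj)
    (λ na → t0 , h , ¬anyBelow⇒¬T t0 g (T-not-intro na))

anyF-mono : ∀ n (f g : Fin n → Bool) → (∀ i → T (f i) → T (g i)) → T (anyF n f) → T (anyF n g)
anyF-mono (suc n) f g h t with T-∨-elim {f fz} t
... | inj₁ t1 = T-∨ˡ (h fz t1)
... | inj₂ t2 = T-∨ʳ {g fz} (anyF-mono n _ _ (λ i → h (fs i)) t2)

anyF⇒∃ : ∀ n (f : Fin n → Bool) → T (anyF n f) → ∃ λ i → T (f i)
anyF⇒∃ (suc n) f t with T-∨-elim {f fz} t
... | inj₁ t1 = fz , t1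
... | inj₂ t2 = let (i , ti) = anyF⇒∃ n _ t2 in fs i , ti

T⇒anyF : ∀ n (f : Fin n → Bool) i → T (f i) → T (anyF n f)
T⇒anyF (suc n) f fz t = T-∨ˡ t
T⇒anyF (suc n) f (fs i) t = T-∨ʳ {f fz} (T⇒anyF n _ i t)

indicator : Bool → ℕ
indicator b = if b then 1 else 0

indicator-true-false : ∀ {a b} → T a → ¬ T b → indicator a + indicator b ≡ 1
indicator-true-false {true} {false} _ _ = refl
indicator-true-false {true} {true} _ h = ⊥-elim (h tt)

indicator-false-true : ∀ {a b} → ¬ T a → T b → indicator a + indicator b ≡ 1
indicator-false-true {false} {true} _ _ = refl
indicator-false-true {true} h _ = ⊥-elim (h tt)

isolatedAt : (H : Graph) → Fin (n H) → Bool
isolatedAt H z = not (anyF (n H) (λ v → adj H z v))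

count-at : ∀ n (u : Fin n) (b : Bool) → count n (λ z → (z == u) ∧ b) ≤ indicator b
count-at n u false = ≤-reflexive (count-≡0 n _ (λ i t → T-∧ʳ {i == u} t))
count-at n u true = count-≤1 n _ (λ i j ti tj → trans (==⇒≡ (T-∧ˡ ti)) (sym (==⇒≡ (T-∧ˡ tj))))

-- Faces of a rotation system

module DartOrder (H : Graph) where

  key : Dart H → ℕ
  key (a , b) = toℕ a * n H + toℕ b

  dartLt-key : ∀ d e → T (dartLt H d e) → key d < key e
  dartLt-key (a , b) (c , d) t with T-∨-elim {toℕ a <ᵇ toℕ c} t
  ... | inj₁ t1 = let a<c = <ᵇ⇒< (toℕ a) (toℕ c) t1 in begin-strict
      toℕ a * n H + toℕ b <⟨ +-monoʳ-< (toℕ a * n H) (toℕ<n b) ⟩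
      toℕ a * n H + n H   ≡⟨ +-comm (toℕ a * n H) (n H) ⟩
      suc (toℕ a) * n H   ≤⟨ *-monoˡ-≤ (n H) a<c ⟩
      toℕ c * n H         ≤⟨ m≤m+n _ _ ⟩
      toℕ c * n H + toℕ d ∎
    where open ≤-Reasoning
  ... | inj₂ t2 with ==⇒≡ {a = a} {c} (T-∧ˡ t2)
  ... | refl = +-monoʳ-< (toℕ a * n H) (<ᵇ⇒< (toℕ b) (toℕ d) (T-∧ʳ {a == a} t2))

  dartLt-connex : ∀ d e → ¬ T (dartLt H d e) → ¬ T (dartLt H e d) → d ≡ e
  dartLt-connex (a , b) (c , d) h1 h2 = same-tail (toℕ-injective (≤-antisym
      (≮ᵇ⇒≥ (toℕ c) (toℕ a) (λ t → h2 (T-∨ˡ t))) (≮ᵇ⇒≥ (toℕ a) (toℕ c) (λ t → h1 (T-∨ˡ t))))) h1 h2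
    where
    ≮ᵇ⇒≥ : ∀ i j → ¬ T (i <ᵇ j) → j ≤ i
    ≮ᵇ⇒≥ i j h = ≮⇒≥ (λ i<j → h (<⇒<ᵇ i<j))
    same-tail : a ≡ c → ¬ T (dartLt H (a , b) (c , d)) → ¬ T (dartLt H (c , d) (a , b)) → (a , b) ≡ (c , d)
    same-tail refl h1 h2 = cong (a ,_) (toℕ-injective (≤-antisym
      (≮ᵇ⇒≥ (toℕ d) (toℕ b) (λ t → h2 (T-∨ʳ {toℕ a <ᵇ toℕ a} (T-∧-intro (≡⇒== refl) t))))
      (≮ᵇ⇒≥ (toℕ b) (toℕ d) (λ t → h1 (T-∨ʳ {toℕ a <ᵇ toℕ a} (T-∧-intro (≡⇒== refl) t))))))

module FaceOrbits (H : Graph) (R : Rotation H) where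
  open Rotation R
  open DartOrder H

  N : ℕ
  N = n H * n H

  f : Dart H → Dart H
  f = faceMap H R

  valid : Dart H → Set
  valid d = T (adj H (proj₁ d) (proj₂ d))

  f-valid : ∀ d → valid d → valid (f d)
  f-valid (a , b) v = ρ-nbr b a (subst T (adj-sym H a b) v)

  iter-valid : ∀ j d → valid d → valid (iter j f d)
  iter-valid zero d v = v
  iter-valid (suc j) d v = f-valid _ (iter-valid j d v)

  f-inj : ∀ d e → valid d → valid e → f d ≡ f e → d ≡ e
  f-inj (a , b) (c , d) v1 v2 eq with cong proj₁ eq
  ... | refl = cong (_, b) (ρ-inj b a c (subst T (adj-sym H a b) v1) (subst T (adj-sym H c b) v2) (cong proj₂ eq))

  iter-inj : ∀ j d e → valid d → valid e → iter j f d ≡ iter j f e → d ≡ e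
  iter-inj zero d e v1 v2 eq = eq
  iter-inj (suc j) d e v1 v2 eq = iter-inj j d e v1 v2 (f-inj _ _ (iter-valid j d v1) (iter-valid j e v2) eq)

  enc : Dart H → Fin N
  enc (a , b) = combine a b

  enc-inj : ∀ d e → enc d ≡ enc e → d ≡ e
  enc-inj (a , b) (c , d) eq = cong₂ _,_ (combine-injectiveˡ a b c d eq) (combine-injectiveʳ a b c d eq)

  period : ∀ d → valid d → ∃ λ P → 0 < P × P ≤ N × iter P f d ≡ d
  period d v with pigeonhole (n<1+n N) (λ i → enc (iter (toℕ i) f d))
  ... | i , j , i<j , eq =
    let a = toℕ i ; b = toℕ j
        e1 : iter a f d ≡ iter a f (iter (b ∸ a) f d)
        e1 = trans (enc-inj _ _ eq) (trans (cong (λ k → iter k f d) (sym (m+[n∸m]≡n (<⇒≤ i<j)))) (iter-add f a (b ∸ a) d))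
    in b ∸ a , m<n⇒0<n∸m i<j , ≤-trans (m∸n≤m b a) (≤-pred (toℕ<n j)) ,
       sym (iter-inj a d _ v (iter-valid (b ∸ a) d v) e1)

  reduce-P : ∀ d P → 0 < P → iter P f d ≡ d → ∀ j → ∃ λ r → r < P × iter j f d ≡ iter r f d
  reduce-P d (suc P) _ eq j =
    j % suc P , m%n<n j (suc P) ,
    trans (cong (λ k → iter k f d) (m≡m%n+[m/n]*n j (suc P)))
      (trans (iter-add f (j % suc P) _ d) (cong (iter (j % suc P) f) (iter-mul f (suc P) d eq (j / suc P))))

  reduce : ∀ d → valid d → ∀ j → ∃ λ r → r < N × iter j f d ≡ iter r f d
  reduce d v j with period d v
  ... | P , 0<P , P≤N , eq with reduce-P d P 0<P eq j
  ... | r , r<P , e = r , <-≤-trans r<P P≤N , e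

  face-length : ∀ d → valid d → ∃ λ l → 0 < l × iter l f d ≡ d × (∀ j → 0 < j → j < l → iter j f d ≢ d)
  face-length d v =
    let (P , 0<P , _ , per) = period d v
        (t , per-t , min-t) = minimal-witness (λ t → iter (suc t) f d ==ᴰ d) (pred P)
                                (≡⇒==ᴰ _ _ (trans (iter-pred f P 0<P d) per))
    in suc t , s≤s z≤n , ==ᴰ⇒≡ _ _ per-t , λ { (suc j) _ j<l eq → min-t j (≤-pred j<l) (≡⇒==ᴰ _ _ eq) }

  Orb : Dart H → Dart H → Set
  Orb d e = ∃ λ j → iter j f d ≡ e

  orb-trans : ∀ {d e g} → Orb d e → Orb e g → Orb d g
  orb-trans {d} (j , refl) (k , refl) = k + j , iter-add f k j d

  orb-sym : ∀ d e → valid d → Orb d e → Orb e d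
  orb-sym d e v (j , refl) with period d v
  ... | P , 0<P , _ , eq with reduce-P d P 0<P eq j
  ... | r , r<P , e2 = P ∸ r , trans (cong (iter (P ∸ r) f) e2) (trans (sym (iter-add f (P ∸ r) r d)) (trans (cong (λ k → iter k f d) (m∸n+n≡m (<⇒≤ r<P))) eq))

  rep : Dart H → Set
  rep d = T (faceRep H R d)

  rep-valid : ∀ d → rep d → valid d
  rep-valid d t = T-∧ˡ t

  rep-min : ∀ d → rep d → ∀ j → j < N → ¬ T (dartLt H (iter j f d) d)
  rep-min d t j j<N = ¬anyBelow⇒¬T N _ (T-∧ʳ {adj H (proj₁ d) (proj₂ d)} t) j j<N

  rep-mk : ∀ d → valid d → (∀ j → j < N → ¬ T (dartLt H (iter j f d) d)) → rep d
  rep-mk d v h = T-∧-intro v (∀¬T⇒¬anyBelow N _ h)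

  rep-unique : ∀ d e → rep d → rep e → Orb d e → d ≡ e
  rep-unique d e rd re o =
    let vd = rep-valid d rd ; ve = rep-valid e re
        (j , eq) = o
        (r , r<N , er) = reduce d vd j
        (j' , eq') = orb-sym d e vd o
        (r' , r'<N , er') = reduce e ve j'
    in dartLt-connex d e (λ t → rep-min e re r' r'<N (subst (λ z → T (dartLt H z e)) (sym (trans (sym er') eq')) t))
                  (λ t → rep-min d rd r r<N (subst (λ z → T (dartLt H z d)) (sym (trans (sym er) eq)) t))

  rep-exists : ∀ d → valid d → ∃ λ r → rep r × Orb d r
  rep-exists d v = go (suc (key d)) d v ≤-refl
    where
    go : ∀ fuel d → valid d → key d < fuel → ∃ λ r → rep r × Orb d r
    go (suc fuel) d v k<f with anyBelow N (λ j → dartLt H (iter j f d) d) in e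
    ... | false = d , T-∧-intro v (subst (λ b → T (not b)) (sym e) tt) , 0 , refl
    ... | true with anyBelow⇒∃ N _ (subst T (sym e) tt)
    ... | j , j<N , t with go fuel (iter j f d) (iter-valid j d v) (<-≤-trans (dartLt-key (iter j f d) d t) (≤-pred k<f))
    ... | r , rr , o = r , rr , orb-trans (j , refl) o

-- Deleting and inserting an edge

module Deletion (G : Graph) (u w : Fin (n G)) where
  G₀ : Graph
  G₀ = deleteEdge G u w

  isDeleted : Fin (n G) → Fin (n G) → Bool
  isDeleted a b = (a == u) ∧ (b == w) ∨ (a == w) ∧ (b == u)

  isDeleted-sym : ∀ a b → T (isDeleted a b) → T (isDeleted b a)
  isDeleted-sym a b t with T-∨-elim {(a == u) ∧ (b == w)} t
  ... | inj₁ t1 = T-∨ʳ {(b == u) ∧ (a == w)} (T-∧-intro (T-∧ʳ {a == u} t1) (T-∧ˡ t1))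
  ... | inj₂ t2 = T-∨ˡ (T-∧-intro (T-∧ʳ {a == w} t2) (T-∧ˡ t2))

  isDeleted⇒ : ∀ a b → T (isDeleted a b) → (a ≡ u × b ≡ w) ⊎ (a ≡ w × b ≡ u)
  isDeleted⇒ a b t with T-∨-elim {(a == u) ∧ (b == w)} t
  ... | inj₁ t1 = inj₁ (==⇒≡ (T-∧ˡ t1) , ==⇒≡ (T-∧ʳ {a == u} t1))
  ... | inj₂ t2 = inj₂ (==⇒≡ (T-∧ˡ t2) , ==⇒≡ (T-∧ʳ {a == w} t2))

  isDeleted-uw : T (isDeleted u w)
  isDeleted-uw = T-∨ˡ {(u == u) ∧ (w == w)} (T-∧-intro {u == u} (≡⇒== refl) (≡⇒== refl))

  adj-deleteEdge⇒adj : ∀ a b → T (adj G₀ a b) → T (adj G a b)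
  adj-deleteEdge⇒adj a b t with T-∨-elim {adj G a b ∧ not (isDeleted a b)} (T-∧ʳ {not (a == b)} t)
  ... | inj₁ t1 = T-∧ˡ t1
  ... | inj₂ t2 = subst T (adj-sym G b a) (T-∧ˡ t2)

  isDeleted⇒¬adj : ∀ a b → T (isDeleted a b) → ¬ T (adj G₀ a b)
  isDeleted⇒¬adj a b c t with T-∨-elim {adj G a b ∧ not (isDeleted a b)} (T-∧ʳ {not (a == b)} t)
  ... | inj₁ t1 = T-not-elim (T-∧ʳ {adj G a b} t1) c
  ... | inj₂ t2 = T-not-elim (T-∧ʳ {adj G b a} t2) (isDeleted-sym a b c)

  adj⇒adj-deleteEdge : ∀ a b → T (adj G a b) → ¬ T (isDeleted a b) → T (adj G₀ a b)
  adj⇒adj-deleteEdge a b t c = T-∧-intro (T-not-intro (λ e → loop (==⇒≡ e))) (T-∨ˡ (T-∧-intro t (T-not-intro c)))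
    where
    loop : a ≡ b → ⊥
    loop refl = subst T (adj-irr G a) t

  reach-deleteEdge : ∀ t a b → T (reach G₀ t a b) → T (reach G t a b)
  reach-deleteEdge zero a b h = h
  reach-deleteEdge (suc t) a b h with T-∨-elim {reach G₀ t a b} h
  ... | inj₁ h1 = T-∨ˡ (reach-deleteEdge t a b h1)
  ... | inj₂ h2 = T-∨ʳ {reach G t a b} (anyF-mono (n G) _ _
    (λ z tz → T-∧-intro (reach-deleteEdge t a z (T-∧ˡ tz)) (adj-deleteEdge⇒adj z b (T-∧ʳ {reach G₀ t a z} tz))) h2)

  components-deleteEdge : components G ≤ components G₀
  components-deleteEdge = count-mono (n G) _ _ (λ z t → T-not-intro (λ t2 → T-not-elim t (anyF-mono (n G) _ _
    (λ v tv → T-∧-intro (T-∧ˡ tv) (reach-deleteEdge (n G) v z (T-∧ʳ {toℕ v <ᵇ toℕ z} tv))) t2)))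

  open PairCount (n G)

  edges-deleteEdge : edges G ≤ edges G₀ + 1
  edges-deleteEdge = ≤-trans (countPairs-mono _ _ edge⇒edge₀-or-deleted)
    (≤-trans (countPairs-∨ edge₀ deletedPair) (+-monoʳ-≤ (edges G₀) (countPairs-≤1 deletedPair at-most-one-deleted)))
    where
    edge₀ : Fin (n G) × Fin (n G) → Bool
    edge₀ d = (toℕ (proj₁ d) <ᵇ toℕ (proj₂ d)) ∧ adj G₀ (proj₁ d) (proj₂ d)
    deletedPair : Fin (n G) × Fin (n G) → Bool
    deletedPair d = (toℕ (proj₁ d) <ᵇ toℕ (proj₂ d)) ∧ isDeleted (proj₁ d) (proj₂ d)
    edge⇒edge₀-or-deleted : ∀ d → T ((toℕ (proj₁ d) <ᵇ toℕ (proj₂ d)) ∧ adj G (proj₁ d) (proj₂ d)) → T (edge₀ d ∨ deletedPair d)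
    edge⇒edge₀-or-deleted (a , b) t = T-case (isDeleted a b)
      (λ c → T-∨ʳ {edge₀ (a , b)} (T-∧-intro {toℕ a <ᵇ toℕ b} (T-∧ˡ t) c))
      (λ c → T-∨ˡ {edge₀ (a , b)} (T-∧-intro {toℕ a <ᵇ toℕ b} (T-∧ˡ t) (adj⇒adj-deleteEdge a b (T-∧ʳ {toℕ a <ᵇ toℕ b} t) c)))
    <ᵇ-asym : ∀ x y → T (x <ᵇ y) → T (y <ᵇ x) → ⊥
    <ᵇ-asym x y t1 t2 = <-asym (<ᵇ⇒< x y t1) (<ᵇ⇒< y x t2)
    at-most-one-deleted : ∀ d e → T (deletedPair d) → T (deletedPair e) → d ≡ e
    at-most-one-deleted (a , b) (c , d) t1 t2 with isDeleted⇒ a b (T-∧ʳ {toℕ a <ᵇ toℕ b} t1) | isDeleted⇒ c d (T-∧ʳ {toℕ c <ᵇ toℕ d} t2)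
    ... | inj₁ (refl , refl) | inj₁ (refl , refl) = refl
    ... | inj₂ (refl , refl) | inj₂ (refl , refl) = refl
    ... | inj₁ (refl , refl) | inj₂ (refl , refl) = ⊥-elim (<ᵇ-asym (toℕ u) (toℕ w) (T-∧ˡ t1) (T-∧ˡ t2))
    ... | inj₂ (refl , refl) | inj₁ (refl , refl) = ⊥-elim (<ᵇ-asym (toℕ w) (toℕ u) (T-∧ˡ t1) (T-∧ˡ t2))

  isolatedAt-deleteEdge : ∀ z → T (isolatedAt G₀ z) → T (isolatedAt G z ∨ ((z == u) ∧ isolatedAt G₀ u) ∨ ((z == w) ∧ isolatedAt G₀ w))
  isolatedAt-deleteEdge z t with anyF (n G) (λ v → adj G z v) in e
  ... | false = T-∨ˡ {true} {((z == u) ∧ isolatedAt G₀ u) ∨ ((z == w) ∧ isolatedAt G₀ w)} tt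
  ... | true with anyF⇒∃ (n G) _ (subst T (sym e) tt)
  ... | v , tv = T-case (isDeleted z v) (λ c → endpoint (isDeleted⇒ z v c)) (λ c → ⊥-elim (T-not-elim t (T⇒anyF (n G) _ v (adj⇒adj-deleteEdge z v tv c))))
    where
    endpoint : (z ≡ u × v ≡ w) ⊎ (z ≡ w × v ≡ u) → T (false ∨ ((z == u) ∧ isolatedAt G₀ u) ∨ ((z == w) ∧ isolatedAt G₀ w))
    endpoint (inj₁ (refl , refl)) = T-∨ʳ {false} (T-∨ˡ {(u == u) ∧ isolatedAt G₀ u} (T-∧-intro {u == u} (≡⇒== refl) t))
    endpoint (inj₂ (refl , refl)) = T-∨ʳ {false} (T-∨ʳ {(w == u) ∧ isolatedAt G₀ u} (T-∧-intro {w == w} (≡⇒== refl) t))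

  isolated-deleteEdge : isolated G₀ ≤ isolated G + indicator (isolatedAt G₀ u) + indicator (isolatedAt G₀ w)
  isolated-deleteEdge = ≤-trans (count-mono (n G) _ _ isolatedAt-deleteEdge)
    (≤-trans (count-∨ (n G) _ _) (≤-trans (+-monoʳ-≤ (isolated G) (count-∨ (n G) _ _))
      (+-mono-≤-reassoc (isolated G) _ _ _ _ (count-at (n G) u (isolatedAt G₀ u)) (count-at (n G) w (isolatedAt G₀ w)))))
    where
    +-mono-≤-reassoc : ∀ a b c d e → b ≤ d → c ≤ e → a + (b + c) ≤ a + d + e
    +-mono-≤-reassoc a b c d e p q = ≤-trans (+-monoʳ-≤ a (+-mono-≤ p q)) (≤-reflexive (sym (+-assoc a d e)))

module CyclicInsertion {m : ℕ} (g : Fin m → Fin m) (N N₀ : Fin m → Set) (new k : Fin m)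
  (new∈N : N new) (new∉N₀ : ¬ N₀ new) (N₀⊆N : ∀ z → N₀ z → N z) (N⇒N₀ : ∀ z → N z → z ≢ new → N₀ z)
  (g-closed : ∀ z → N₀ z → N₀ (g z)) (g-inj : ∀ a b → N₀ a → N₀ b → g a ≡ g b → a ≡ b)
  (g-cyc : ∀ a b → N₀ a → N₀ b → ∃ λ j → iter j g a ≡ b)
  (k-or-empty : N₀ k ⊎ (k ≡ new × (∀ z → ¬ N₀ z))) where

  -- g with new spliced in right after k; when N₀ is empty, k = new and ins fixes new.
  ins : Fin m → Fin m
  ins a = if a == k then new else if a == new then g k else g a

  ins-after-k : ins k ≡ new
  ins-after-k rewrite ==-refl k = refl

  ins-new : k ≢ new → ins new ≡ g k
  ins-new ne rewrite ≢⇒==false (λ e → ne (sym e)) | ==-refl new = refl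

  ins-other : ∀ z → z ≢ k → z ≢ new → ins z ≡ g z
  ins-other z n1 n2 rewrite ≢⇒==false n1 | ≢⇒==false n2 = refl

  k≢new : N₀ k → k ≢ new
  k≢new h refl = new∉N₀ h

  ins-nbr : ∀ a → N a → N (ins a)
  ins-nbr a h = ≟-case a k (λ { refl → subst N (sym ins-after-k) new∈N }) λ ak →
    ≟-case a new (λ { refl → help ak k-or-empty }) λ ao → subst N (sym (ins-other a ak ao)) (N₀⊆N _ (g-closed a (N⇒N₀ a h ao)))
    where
    help : new ≢ k → N₀ k ⊎ (k ≡ new × (∀ z → ¬ N₀ z)) → N (ins new)
    help ak (inj₁ nk) = subst N (sym (ins-new (k≢new nk))) (N₀⊆N _ (g-closed k nk))
    help ak (inj₂ (e , _)) = ⊥-elim (ak (sym e))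

  ins-cases : ∀ a → N a → (a ≡ k × ins a ≡ new) ⊎ (a ≢ k × N₀ (ins a))
  ins-cases a h = ≟-case a k (λ { refl → inj₁ (refl , ins-after-k) }) λ ak →
    ≟-case a new (λ { refl → help ak k-or-empty }) λ ao → inj₂ (ak , subst N₀ (sym (ins-other a ak ao)) (g-closed a (N⇒N₀ a h ao)))
    where
    help : new ≢ k → N₀ k ⊎ (k ≡ new × (∀ z → ¬ N₀ z)) → (new ≡ k × ins new ≡ new) ⊎ (new ≢ k × N₀ (ins new))
    help ak (inj₁ nk) = inj₂ (ak , subst N₀ (sym (ins-new (k≢new nk))) (g-closed k nk))
    help ak (inj₂ (e , _)) = ⊥-elim (ak (sym e))

  ins-via-g : ∀ a → N a → a ≢ k → N₀ k × ((a ≡ new × ins a ≡ g k) ⊎ (N₀ a × ins a ≡ g a))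
  ins-via-g a h ak = go k-or-empty
    where
    go : N₀ k ⊎ (k ≡ new × (∀ z → ¬ N₀ z)) → N₀ k × ((a ≡ new × ins a ≡ g k) ⊎ (N₀ a × ins a ≡ g a))
    go (inj₂ (e , none)) = ⊥-elim (ak (≟-case a new (λ e2 → trans e2 (sym e)) (λ ne → ⊥-elim (none a (N⇒N₀ a h ne)))))
    go (inj₁ nk) = nk , ≟-case a new (λ { refl → inj₁ (refl , ins-new (k≢new nk)) }) (λ ao → inj₂ (N⇒N₀ a h ao , ins-other a ak ao))

  ins-inj : ∀ a b → N a → N b → ins a ≡ ins b → a ≡ b
  ins-inj a b ha hb eq with ins-cases a ha | ins-cases b hb
  ... | inj₁ (refl , _) | inj₁ (refl , _) = refl
  ... | inj₁ (refl , e1) | inj₂ (_ , n2) = ⊥-elim (new∉N₀ (subst N₀ (trans (sym eq) e1) n2))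
  ... | inj₂ (_ , n1) | inj₁ (refl , e2) = ⊥-elim (new∉N₀ (subst N₀ (trans eq e2) n1))
  ... | inj₂ (ak , n1) | inj₂ (bk , n2) with ins-via-g a ha ak | ins-via-g b hb bk
  ... | nk , inj₁ (refl , e1) | _ , inj₁ (refl , e2) = refl
  ... | nk , inj₁ (refl , e1) | _ , inj₂ (nb , e2) = ⊥-elim (bk (sym (g-inj k b nk nb (trans (sym e1) (trans eq e2)))))
  ... | nk , inj₂ (na , e1) | _ , inj₁ (refl , e2) = ⊥-elim (ak (g-inj a k na nk (trans (sym e1) (trans eq e2))))
  ... | nk , inj₂ (na , e1) | _ , inj₂ (nb , e2) = g-inj a b na nb (trans (sym e1) (trans eq e2))

  Reach : Fin m → Fin m → Set
  Reach a z = ∃ λ j → iter j ins a ≡ z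

  reach-ins : ∀ {a z} → Reach a z → Reach a (ins z)
  reach-ins (j , e) = suc j , cong ins e

  module _ (nk : N₀ k) where
    reach-g : ∀ {a z} → N₀ z → Reach a z → Reach a (g z)
    reach-g {a} {z} nz r = ≟-case z k
      (λ { refl → subst (Reach a) (trans (cong ins ins-after-k) (ins-new (k≢new nk))) (reach-ins (reach-ins r)) })
      (λ zk → subst (Reach a) (ins-other z zk (λ e → new∉N₀ (subst N₀ e nz))) (reach-ins r))

    reach-iter-g : ∀ {a z} → N₀ z → Reach a z → ∀ j → Reach a (iter j g z)
    reach-iter-g nz r zero = r
    reach-iter-g {a} {z} nz r (suc j) = reach-g (it-nb j) (reach-iter-g nz r j)
      where
      it-nb : ∀ j → N₀ (iter j g z)
      it-nb zero = nz
      it-nb (suc j) = g-closed _ (it-nb j)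

  ins-cyc : ∀ a b → N a → N b → ∃ λ j → iter j ins a ≡ b
  ins-cyc a b ha hb = go k-or-empty
    where
    go : N₀ k ⊎ (k ≡ new × (∀ z → ¬ N₀ z)) → ∃ λ j → iter j ins a ≡ b
    go (inj₂ (_ , none)) = 0 , trans (only-new a ha) (sym (only-new b hb))
      where
      only-new : ∀ a → N a → a ≡ new
      only-new a h = ≟-case a new (λ e → e) (λ ne → ⊥-elim (none a (N⇒N₀ a h ne)))
    go (inj₁ nk) = ≟-case a new (λ { refl → from-new }) from-old
      where
      from-new : ∃ λ j → iter j ins new ≡ b
      from-new = ≟-case b new (λ { refl → 0 , refl }) λ bo →
        let (j , ej) = g-cyc (g k) b (g-closed k nk) (N⇒N₀ b hb bo) in
        subst (Reach new) ej (reach-iter-g nk (g-closed k nk) (1 , ins-new (k≢new nk)) j)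
      from-old : a ≢ new → ∃ λ j → iter j ins a ≡ b
      from-old ao = ≟-case b new (λ { refl →
          let (j , ej) = g-cyc a k (N⇒N₀ a ha ao) nk in
          subst (Reach a) (trans (cong ins ej) ins-after-k) (reach-ins (reach-iter-g nk (N⇒N₀ a ha ao) (0 , refl) j)) })
        λ bo →
          let (j , ej) = g-cyc a b (N⇒N₀ a ha ao) (N⇒N₀ b hb bo) in
          subst (Reach a) ej (reach-iter-g nk (N⇒N₀ a ha ao) (0 , refl) j)

insertion-genus-arithmetic : ∀ c c₀ E E₀ j V F₀ I₀ F I a₁ a₂ b₁ b₂ → c ≤ c₀ → E ≤ E₀ + 1
  → 2 * c₀ + E₀ ≤ 2 * j + V + (F₀ + I₀) → F₀ + 1 ≤ F + (a₁ + a₂) → I₀ ≤ I + b₁ + b₂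
  → a₁ + b₁ ≡ 1 → a₂ + b₂ ≡ 1 → 2 * c + E ≤ 2 * suc j + V + (F + I)
insertion-genus-arithmetic c c₀ E E₀ j V F₀ I₀ F I a₁ a₂ b₁ b₂ c≤ E≤ genus₀ F₀≤ I₀≤ a₁+b₁ a₂+b₂ = begin
  2 * c + E                                     ≤⟨ +-mono-≤ (*-monoʳ-≤ 2 c≤) E≤ ⟩
  2 * c₀ + (E₀ + 1)                             ≡⟨ +-assoc (2 * c₀) E₀ 1 ⟨
  2 * c₀ + E₀ + 1                               ≤⟨ +-monoˡ-≤ 1 genus₀ ⟩
  2 * j + V + (F₀ + I₀) + 1                     ≡⟨ reassoc j V F₀ I₀ ⟩
  2 * j + V + (F₀ + 1) + I₀                     ≤⟨ +-mono-≤ (+-monoʳ-≤ (2 * j + V) F₀≤) I₀≤ ⟩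
  2 * j + V + (F + (a₁ + a₂)) + (I + b₁ + b₂)   ≡⟨ regroup j V F I a₁ a₂ b₁ b₂ ⟩
  2 * j + V + (F + I) + ((a₁ + b₁) + (a₂ + b₂)) ≡⟨ cong₂ (λ s t → 2 * j + V + (F + I) + (s + t)) a₁+b₁ a₂+b₂ ⟩
  2 * j + V + (F + I) + 2                       ≡⟨ two j V F I ⟩
  2 * suc j + V + (F + I)                       ∎
  where
  open ≤-Reasoning
  reassoc : ∀ j V F₀ I₀ → 2 * j + V + (F₀ + I₀) + 1 ≡ 2 * j + V + (F₀ + 1) + I₀
  reassoc = solve-∀
  regroup : ∀ j V F I a₁ a₂ b₁ b₂
    → 2 * j + V + (F + (a₁ + a₂)) + (I + b₁ + b₂) ≡ 2 * j + V + (F + I) + ((a₁ + b₁) + (a₂ + b₂))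
  regroup = solve-∀
  two : ∀ j V F I → 2 * j + V + (F + I) + 2 ≡ 2 * suc j + V + (F + I)
  two = solve-∀

sameFace-genus-arithmetic : ∀ c c₀ E E₀ j V F₀ I₀ F I → c ≤ c₀ → E ≤ E₀ + 1
  → 2 * c₀ + E₀ ≤ 2 * j + V + (F₀ + I₀) → F₀ + 1 ≤ F → I₀ ≤ I
  → 2 * c + E ≤ 2 * j + V + (F + I)
sameFace-genus-arithmetic c c₀ E E₀ j V F₀ I₀ F I c≤ E≤ genus₀ F₀< I₀≤ = begin
  2 * c + E                   ≤⟨ +-mono-≤ (*-monoʳ-≤ 2 c≤) E≤ ⟩
  2 * c₀ + (E₀ + 1)           ≡⟨ +-assoc (2 * c₀) E₀ 1 ⟨
  2 * c₀ + E₀ + 1             ≤⟨ +-monoˡ-≤ 1 genus₀ ⟩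
  2 * j + V + (F₀ + I₀) + 1   ≡⟨ regroup j V F₀ I₀ ⟩
  2 * j + V + ((F₀ + 1) + I₀) ≤⟨ +-monoʳ-≤ (2 * j + V) (+-mono-≤ F₀< I₀≤) ⟩
  2 * j + V + (F + I)         ∎
  where
  open ≤-Reasoning
  regroup : ∀ j V F₀ I₀ → 2 * j + V + (F₀ + I₀) + 1 ≡ 2 * j + V + ((F₀ + 1) + I₀)
  regroup = solve-∀

sameFace-faces-arithmetic : ∀ t₀ u₀ t u → t₀ ≤ 1 → u₀ ≤ u → 2 ≤ t → t₀ + u₀ + 1 ≤ t + u
sameFace-faces-arithmetic t₀ u₀ t u t₀≤1 u₀≤u 2≤t = begin
  t₀ + u₀ + 1   ≡⟨ +-comm (t₀ + u₀) 1 ⟩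
  1 + (t₀ + u₀) ≡⟨ +-assoc 1 t₀ u₀ ⟨
  (1 + t₀) + u₀ ≤⟨ +-mono-≤ (≤-trans (+-monoʳ-≤ 1 t₀≤1) 2≤t) u₀≤u ⟩
  t + u         ∎
  where open ≤-Reasoning

module EdgeInsertion (G : Graph) (u w : Fin (n G)) (uw : u ≢ w) (e : T (adj G u w))
  (R₀ : Rotation (deleteEdge G u w)) (p q : Fin (n G))
  (cp : T (adj (deleteEdge G u w) u p) ⊎ (p ≡ w × (∀ z → ¬ T (adj (deleteEdge G u w) u z))))
  (cq : T (adj (deleteEdge G u w) w q) ⊎ (q ≡ u × (∀ z → ¬ T (adj (deleteEdge G u w) w z)))) where

  open Deletion G u w public
  open Rotation R₀ renaming (ρ to ρ₀; ρ-nbr to ρ₀-nbr; ρ-inj to ρ₀-inj; ρ-cyc to ρ₀-cyc)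

  isDeleted-from-u : ∀ z → T (isDeleted u z) → z ≡ w
  isDeleted-from-u z c with isDeleted⇒ u z c
  ... | inj₁ (_ , e) = e
  ... | inj₂ (e , _) = ⊥-elim (uw e)

  isDeleted-from-w : ∀ z → T (isDeleted w z) → z ≡ u
  isDeleted-from-w z c with isDeleted⇒ w z c
  ... | inj₁ (e , _) = ⊥-elim (uw (sym e))
  ... | inj₂ (_ , e) = e

  ¬isDeleted-elsewhere : ∀ b z → b ≢ u → b ≢ w → ¬ T (isDeleted b z)
  ¬isDeleted-elsewhere b z bu bw c with isDeleted⇒ b z c
  ... | inj₁ (e , _) = bu e
  ... | inj₂ (e , _) = bw e

  module AtU = CyclicInsertion (ρ₀ u) (λ z → T (adj G u z)) (λ z → T (adj G₀ u z)) w p e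
    (isDeleted⇒¬adj u w isDeleted-uw) (λ z → adj-deleteEdge⇒adj u z) (λ z h zw → adj⇒adj-deleteEdge u z h (λ c → zw (isDeleted-from-u z c)))
    (ρ₀-nbr u) (ρ₀-inj u) (ρ₀-cyc u) cp

  e' : T (adj G w u)
  e' = subst T (adj-sym G u w) e

  module AtW = CyclicInsertion (ρ₀ w) (λ z → T (adj G w z)) (λ z → T (adj G₀ w z)) u q e'
    (isDeleted⇒¬adj w u (isDeleted-sym u w isDeleted-uw)) (λ z → adj-deleteEdge⇒adj w z) (λ z h zu → adj⇒adj-deleteEdge w z h (λ c → zu (isDeleted-from-w z c)))
    (ρ₀-nbr w) (ρ₀-inj w) (ρ₀-cyc w) cq

  ρ' : Fin (n G) → Fin (n G) → Fin (n G)
  ρ' b a = if b == u then AtU.ins a else if b == w then AtW.ins a else ρ₀ b a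

  ρ'-u : ∀ a → ρ' u a ≡ AtU.ins a
  ρ'-u a rewrite ==-refl u = refl

  ρ'-w : ∀ a → ρ' w a ≡ AtW.ins a
  ρ'-w a rewrite ≢⇒==false (λ x → uw (sym x)) | ==-refl w = refl

  ρ'-o : ∀ b a → b ≢ u → b ≢ w → ρ' b a ≡ ρ₀ b a
  ρ'-o b a bu bw rewrite ≢⇒==false bu | ≢⇒==false bw = refl

  R' : Rotation G
  R' = record { ρ = ρ' ; ρ-nbr = nbr ; ρ-inj = inj ; ρ-cyc = cyc }
    where
    kept : ∀ b a → b ≢ u → b ≢ w → T (adj G b a) → T (adj G₀ b a)
    kept b a bu bw h = adj⇒adj-deleteEdge b a h (¬isDeleted-elsewhere b a bu bw)
    nbr : ∀ b a → T (adj G b a) → T (adj G b (ρ' b a))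
    nbr b a h =
      ≟-case b u (λ { refl → subst (λ z → T (adj G u z)) (sym (ρ'-u a)) (AtU.ins-nbr a h) }) λ bu →
      ≟-case b w (λ { refl → subst (λ z → T (adj G w z)) (sym (ρ'-w a)) (AtW.ins-nbr a h) }) λ bw →
      subst (λ z → T (adj G b z)) (sym (ρ'-o b a bu bw)) (adj-deleteEdge⇒adj b _ (ρ₀-nbr b a (kept b a bu bw h)))
    inj : ∀ b a c → T (adj G b a) → T (adj G b c) → ρ' b a ≡ ρ' b c → a ≡ c
    inj b a c ha hc eq =
      ≟-case b u (λ { refl → AtU.ins-inj a c ha hc (trans (sym (ρ'-u a)) (trans eq (ρ'-u c))) }) λ bu →
      ≟-case b w (λ { refl → AtW.ins-inj a c ha hc (trans (sym (ρ'-w a)) (trans eq (ρ'-w c))) }) λ bw →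
      ρ₀-inj b a c (kept b a bu bw ha) (kept b c bu bw hc) (trans (sym (ρ'-o b a bu bw)) (trans eq (ρ'-o b c bu bw)))
    cyc : ∀ b a c → T (adj G b a) → T (adj G b c) → ∃ λ j → iter j (ρ' b) a ≡ c
    cyc b a c ha hc =
      ≟-case b u (λ { refl → let (j , ej) = AtU.ins-cyc a c ha hc in j , trans (iter-cong _ _ ρ'-u j a) ej }) λ bu →
      ≟-case b w (λ { refl → let (j , ej) = AtW.ins-cyc a c ha hc in j , trans (iter-cong _ _ ρ'-w j a) ej }) λ bw →
      let (j , ej) = ρ₀-cyc b a c (kept b a bu bw ha) (kept b c bu bw hc)
      in j , trans (iter-cong _ _ (λ z → ρ'-o b z bu bw) j a) ej

  f' : Dart G → Dart G
  f' = faceMap G R'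

  f₀ : Dart G → Dart G
  f₀ = faceMap G₀ R₀

  faceMap-off-corners : ∀ a b → T (adj G₀ a b) → (a , b) ≢ (p , u) → (a , b) ≢ (q , w) → f' (a , b) ≡ f₀ (a , b)
  faceMap-off-corners a b h n1 n2 =
    ≟-case b u (λ { refl → cong (u ,_) (trans (ρ'-u a) (AtU.ins-other a (λ x → n1 (cong (_, u) x))
      (λ { refl → isDeleted⇒¬adj w u (isDeleted-sym u w isDeleted-uw) h }))) }) λ bu →
    ≟-case b w (λ { refl → cong (w ,_) (trans (ρ'-w a) (AtW.ins-other a (λ x → n2 (cong (_, w) x))
      (λ { refl → isDeleted⇒¬adj u w isDeleted-uw h }))) }) λ bw →
    cong (b ,_) (ρ'-o b a bu bw)

  faceMap-into-uw : f' (p , u) ≡ (u , w)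
  faceMap-into-uw = cong (u ,_) (trans (ρ'-u p) AtU.ins-after-k)

  faceMap-out-of-uw : T (adj G₀ w q) → f' (u , w) ≡ f₀ (q , w)
  faceMap-out-of-uw h = cong (w ,_) (trans (ρ'-w u) (AtW.ins-new (AtW.k≢new h)))

  module O₀ = FaceOrbits G₀ R₀
  module O' = FaceOrbits G R'
  open PairCount (n G)

  N : ℕ
  N = n G * n G

  adj₀ : Dart G → Bool
  adj₀ d = adj G₀ (proj₁ d) (proj₂ d)

  cu cw : Dart G
  cu = (p , u)
  cw = (q , w)

  bad : Dart G → Bool
  bad c = not (adj₀ c) ∨ not (f' c ==ᴰ f₀ c)

  -- A face of R₀ is touched if it runs through a corner where R' and R₀ differ.  Untouched faces
  -- survive unchanged in R', at most one touched face passes through each corner, and the face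
  -- of R' through (u , w) is touched.
  touched : Dart G → Bool
  touched d = anyBelow N (λ j → bad (iter j f₀ d))

  N-pos : 0 < N
  N-pos = pos u
    where
    pos : ∀ {m} → Fin m → 0 < m * m
    pos {suc k} _ = s≤s z≤n

  untouched-step : ∀ d → ¬ T (touched d) → ∀ j → j < N → T (adj₀ (iter j f₀ d)) × f' (iter j f₀ d) ≡ f₀ (iter j f₀ d)
  untouched-step d h j j<N =
    let nb = ¬anyBelow⇒¬T N _ (T-not-intro h) j j<N in
    not-not (λ t → nb (T-∨ˡ t)) , ==ᴰ⇒≡ _ _ (not-not (λ t → nb (T-∨ʳ {not (adj₀ (iter j f₀ d))} t)))
    where
    not-not : ∀ {b} → ¬ T (not b) → T b
    not-not {true} _ = tt
    not-not {false} h = h tt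

  untouched-agree : ∀ d → ¬ T (touched d) → ∀ j → j ≤ N → iter j f' d ≡ iter j f₀ d
  untouched-agree d h zero _ = refl
  untouched-agree d h (suc j) sj≤N = trans (cong f' (untouched-agree d h j (<⇒≤ sj≤N))) (proj₂ (untouched-step d h j sj≤N))

  untouched-valid : ∀ d → ¬ T (touched d) → T (adj₀ d)
  untouched-valid d h = proj₁ (untouched-step d h 0 N-pos)

  rep-transfer : ∀ d → O₀.rep d → ¬ T (touched d) → O'.rep d
  rep-transfer d r h = O'.rep-mk d (adj-deleteEdge⇒adj _ _ (O₀.rep-valid d r))
    (λ j j<N t → O₀.rep-min d r j j<N (subst (λ z → T (dartLt G₀ z d)) (untouched-agree d h j (<⇒≤ j<N)) t))

  touched-orb : ∀ d → T (adj₀ d) → T (touched d) → (O₀.Orb d cu × T (adj₀ cu)) ⊎ (O₀.Orb d cw × T (adj₀ cw))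
  touched-orb d v t with anyBelow⇒∃ N _ t
  ... | j , j<N , tb with T-∨-elim {not (adj₀ (iter j f₀ d))} tb
  ...   | inj₁ nv = ⊥-elim (T-not-elim nv (O₀.iter-valid j d v))
  ...   | inj₂ nf = ≟ᴰ-case (iter j f₀ d) cu (λ x → inj₁ ((j , x) , subst (λ z → T (adj₀ z)) x (O₀.iter-valid j d v))) λ n1 →
                    ≟ᴰ-case (iter j f₀ d) cw (λ x → inj₂ ((j , x) , subst (λ z → T (adj₀ z)) x (O₀.iter-valid j d v))) λ n2 →
                    ⊥-elim (T-not-elim nf (≡⇒==ᴰ _ _ (faceMap-off-corners _ _ (O₀.iter-valid j d v) n1 n2)))

  new-touched : ∀ m z → O'.Orb m z → ¬ T (adj₀ z) → T (adj G (proj₁ m) (proj₂ m)) → T (touched m)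
  new-touched m z o nz vm = T-case (touched m) (λ t → t) λ h →
    let (i , i<N , ei) = O'.reduce m vm (proj₁ o) in
    ⊥-elim (nz (subst (λ y → T (adj₀ y)) (trans (sym (untouched-agree m h i (<⇒≤ i<N))) (trans (sym ei) (proj₂ o))) (O₀.iter-valid i m (untouched-valid m h))))

  inOrb : Dart G → Dart G → Bool
  inOrb c d = anyBelow N (λ j → iter j f₀ d ==ᴰ c)

  inOrb-mk : ∀ c d → T (adj₀ d) → O₀.Orb d c → T (inOrb c d)
  inOrb-mk c d v (j , ej) = let (r , r<N , er) = O₀.reduce d v j in
    T⇒anyBelow N _ r r<N (≡⇒==ᴰ _ _ (trans (sym er) ej))

  inOrb-e : ∀ c d → T (inOrb c d) → O₀.Orb d c
  inOrb-e c d t = let (j , _ , tj) = anyBelow⇒∃ N _ t in j , ==ᴰ⇒≡ _ _ tj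

  rep₀B : Dart G → Bool
  rep₀B = faceRep G₀ R₀

  rep'B : Dart G → Bool
  rep'B = faceRep G R'

  orbit-count : ∀ c → countPairs (λ d → rep₀B d ∧ (inOrb c d ∧ adj₀ c)) ≤ indicator (adj₀ c)
  orbit-count c = T-case (adj₀ c)
    (λ vc → subst (λ b → countPairs (λ d → rep₀B d ∧ (inOrb c d ∧ b)) ≤ indicator b) (sym (T⇒≡true vc))
       (countPairs-≤1 _ (λ d d' t t' →
          let rd = T-∧ˡ t ; rd' = T-∧ˡ t'
              o1 = inOrb-e c d (T-∧ˡ (T-∧ʳ {rep₀B d} t))
              o2 = inOrb-e c d' (T-∧ˡ (T-∧ʳ {rep₀B d'} t'))
          in O₀.rep-unique d d' rd rd' (O₀.orb-trans o1 (O₀.orb-sym d' c (O₀.rep-valid d' rd') o2)))))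
    (λ nc → ≤-trans (≤-reflexive (countPairs-≡0 _ (λ d t → nc (T-∧ʳ {inOrb c d} (T-∧ʳ {rep₀B d} t))))) z≤n)

  touched-bound : countPairs (λ d → rep₀B d ∧ touched d) ≤ indicator (adj₀ cu) + indicator (adj₀ cw)
  touched-bound = ≤-trans (countPairs-mono _ _ step) (≤-trans (countPairs-∨ _ _) (+-mono-≤ (orbit-count cu) (orbit-count cw)))
    where
    step : ∀ d → T (rep₀B d ∧ touched d) → T ((rep₀B d ∧ (inOrb cu d ∧ adj₀ cu)) ∨ (rep₀B d ∧ (inOrb cw d ∧ adj₀ cw)))
    step d t with touched-orb d (O₀.rep-valid d (T-∧ˡ t)) (T-∧ʳ {rep₀B d} t)
    ... | inj₁ (o , v) = T-∨ˡ {rep₀B d ∧ (inOrb cu d ∧ adj₀ cu)}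
      (T-∧-intro {rep₀B d} (T-∧ˡ t) (T-∧-intro {inOrb cu d} (inOrb-mk cu d (O₀.rep-valid d (T-∧ˡ t)) o) v))
    ... | inj₂ (o , v) = T-∨ʳ {rep₀B d ∧ (inOrb cu d ∧ adj₀ cu)}
      (T-∧-intro {rep₀B d} (T-∧ˡ t) (T-∧-intro {inOrb cw d} (inOrb-mk cw d (O₀.rep-valid d (T-∧ˡ t)) o) v))

  untouched-bound : countPairs (λ d → rep₀B d ∧ not (touched d)) ≤ countPairs (λ d → rep'B d ∧ not (touched d))
  untouched-bound = countPairs-mono _ _ (λ d t → T-∧-intro {rep'B d} (rep-transfer d (T-∧ˡ t) (T-not-elim (T-∧ʳ {rep₀B d} t))) (T-∧ʳ {rep₀B d} t))

  rep-of-uw : ∃ λ m → O'.rep m × T (touched m)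
  rep-of-uw = let (m , rm , o) = O'.rep-exists (u , w) e in
    m , rm , new-touched m (u , w) (O'.orb-sym (u , w) m e o) (isDeleted⇒¬adj u w isDeleted-uw) (O'.rep-valid m rm)

  insertion-faces : dartFaces G₀ R₀ + 1 ≤ dartFaces G R' + (indicator (adj₀ cu) + indicator (adj₀ cw))
  insertion-faces = begin
      dartFaces G₀ R₀ + 1 ≡⟨ cong (_+ 1) (countPairs-split rep₀B touched) ⟩
      countPairs (λ d → rep₀B d ∧ touched d) + countPairs (λ d → rep₀B d ∧ not (touched d)) + 1
        ≤⟨ +-monoˡ-≤ 1 (+-mono-≤ touched-bound untouched-bound) ⟩
      (indicator (adj₀ cu) + indicator (adj₀ cw)) + countPairs (λ d → rep'B d ∧ not (touched d)) + 1
        ≡⟨ regroup (indicator (adj₀ cu) + indicator (adj₀ cw)) _ ⟩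
      1 + countPairs (λ d → rep'B d ∧ not (touched d)) + (indicator (adj₀ cu) + indicator (adj₀ cw))
        ≤⟨ +-monoˡ-≤ _ (+-monoˡ-≤ _ (let (m , rm , tm) = rep-of-uw in T⇒countPairs-pos _ m (T-∧-intro {rep'B m} rm tm))) ⟩
      countPairs (λ d → rep'B d ∧ touched d) + countPairs (λ d → rep'B d ∧ not (touched d)) + (indicator (adj₀ cu) + indicator (adj₀ cw))
        ≡⟨ cong (_+ (indicator (adj₀ cu) + indicator (adj₀ cw))) (sym (countPairs-split rep'B touched)) ⟩
      dartFaces G R' + (indicator (adj₀ cu) + indicator (adj₀ cw)) ∎
    where
    open ≤-Reasoning
    regroup : ∀ a b → a + b + 1 ≡ 1 + b + a
    regroup a b = trans (+-comm (a + b) 1) (cong suc (+-comm a b))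

  -- Either there is a corner at c, or c is isolated in G₀ and counted there as a face of its own.
  corner-or-isolated : ∀ c r {o} → T (adj G₀ c r) ⊎ (r ≡ o × (∀ z → ¬ T (adj G₀ c z)))
    → indicator (adj G₀ r c) + indicator (isolatedAt G₀ c) ≡ 1
  corner-or-isolated c r (inj₁ h) =
    indicator-true-false (subst T (adj-sym G₀ c r) h) (λ nt → T-not-elim nt (T⇒anyF (n G) _ r h))
  corner-or-isolated c r (inj₂ (_ , none)) =
    indicator-false-true (λ t → none r (subst T (adj-sym G₀ r c) t))
      (T-not-intro (λ t → let (z , tz) = anyF⇒∃ (n G) _ t in none z tz))

  insertion-genus : ∀ j → GenusLe G₀ R₀ j → GenusLe G R' (suc j)
  insertion-genus j h = insertion-genus-arithmetic (components G) (components G₀) (edges G) (edges G₀) j (n G)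
    (dartFaces G₀ R₀) (isolated G₀) (dartFaces G R') (isolated G)
    (indicator (adj₀ cu)) (indicator (adj₀ cw)) (indicator (isolatedAt G₀ u)) (indicator (isolatedAt G₀ w))
    components-deleteEdge edges-deleteEdge h insertion-faces isolated-deleteEdge
    (corner-or-isolated u p cp) (corner-or-isolated w q cq)

  cu≢cw : cu ≢ cw
  cu≢cw eq = uw (cong proj₂ eq)

  module SameFace (hp : T (adj G₀ u p)) (hq : T (adj G₀ w q)) (cu→cw : O₀.Orb cu cw) where

    cu-edge : T (adj₀ cu)
    cu-edge = subst T (adj-sym G₀ u p) hp
    cw-edge : T (adj₀ cw)
    cw-edge = subst T (adj-sym G₀ w q) hq

    cw→cu : O₀.Orb cw cu
    cw→cu = O₀.orb-sym cu cw cu-edge cu→cw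

    touched-faces₀-≤1 : countPairs (λ d → rep₀B d ∧ touched d) ≤ 1
    touched-faces₀-≤1 = countPairs-≤1 _ (λ d d' t t' →
      let rd = T-∧ˡ t ; rd' = T-∧ˡ t' in
      O₀.rep-unique d d' rd rd' (O₀.orb-trans (→cu d t) (O₀.orb-sym d' cu (O₀.rep-valid d' rd') (→cu d' t'))))
      where
      →cu : ∀ d → T (rep₀B d ∧ touched d) → O₀.Orb d cu
      →cu d t with touched-orb d (O₀.rep-valid d (T-∧ˡ t)) (T-∧ʳ {rep₀B d} t)
      ... | inj₁ (o , _) = o
      ... | inj₂ (o , _) = O₀.orb-trans o cw→cu

    after-cw : ℕ → Dart G
    after-cw t = iter t f₀ (f₀ cw)

    hits-corner : ℕ → Bool
    hits-corner t = (after-cw t ==ᴰ cu) ∨ (after-cw t ==ᴰ cw)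

    after-cw-edge : ∀ t → T (adj₀ (after-cw t))
    after-cw-edge t = O₀.iter-valid t _ (O₀.f-valid cw cw-edge)

    hits-corner-eventually : ∃ λ t → T (hits-corner t)
    hits-corner-eventually with cw→cu
    ... | zero , e0 = ⊥-elim (cu≢cw (sym e0))
    ... | suc j , ej = j , T-∨ˡ {after-cw j ==ᴰ cu} (≡⇒==ᴰ _ _ (trans (sym (iter-suc f₀ j cw)) ej))

    first-hit : ℕ
    first-hit = proj₁ (minimal-witness hits-corner (proj₁ hits-corner-eventually) (proj₂ hits-corner-eventually))
    hits-at-first-hit : T (hits-corner first-hit)
    hits-at-first-hit = proj₁ (proj₂ (minimal-witness hits-corner (proj₁ hits-corner-eventually) (proj₂ hits-corner-eventually)))
    no-earlier-hit : ∀ t' → t' < first-hit → ¬ T (hits-corner t')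
    no-earlier-hit = proj₂ (proj₂ (minimal-witness hits-corner (proj₁ hits-corner-eventually) (proj₂ hits-corner-eventually)))

    agree : ∀ t → t ≤ first-hit → iter (suc t) f' (u , w) ≡ after-cw t
    agree zero _ = faceMap-out-of-uw hq
    agree (suc t) st≤first-hit = trans (cong f' (agree t (<⇒≤ st≤first-hit)))
      (faceMap-off-corners _ _ (after-cw-edge t)
        (λ x → no-earlier-hit t st≤first-hit (T-∨ˡ {after-cw t ==ᴰ cu} (≡⇒==ᴰ _ _ x)))
        (λ x → no-earlier-hit t st≤first-hit (T-∨ʳ {after-cw t ==ᴰ cu} (≡⇒==ᴰ _ _ x))))

    -- Following the face of cw, the first corner reached is cu; so the face of (u , w) in R'
    -- closes up before it could reach (w , u).
    uw-and-wu-on-different-faces : ¬ O'.Orb (u , w) (w , u)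
    uw-and-wu-on-different-faces (j , ej) with T-∨-elim {after-cw first-hit ==ᴰ cu} hits-at-first-hit
    ... | inj₂ t2 =
      let eq : iter (suc first-hit) f₀ cw ≡ cw
          eq = trans (iter-suc f₀ first-hit cw) (==ᴰ⇒≡ _ _ t2)
          (r , r<P , er) = O₀.reduce-P cw (suc first-hit) (s≤s z≤n) eq (proj₁ cw→cu)
      in before-return r r<P (trans (sym er) (proj₂ cw→cu))
      where
      before-return : ∀ r → r < suc first-hit → iter r f₀ cw ≡ cu → ⊥
      before-return zero _ e0 = cu≢cw (sym e0)
      before-return (suc r) r<P er = no-earlier-hit r (≤-pred r<P) (T-∨ˡ {after-cw r ==ᴰ cu} (≡⇒==ᴰ _ _ (trans (sym (iter-suc f₀ r cw)) er)))
    ... | inj₁ t1 =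
      let eq : iter (suc (suc first-hit)) f' (u , w) ≡ (u , w)
          eq = trans (cong f' (trans (agree first-hit ≤-refl) (==ᴰ⇒≡ _ _ t1))) faceMap-into-uw
          (r , r<P , er) = O'.reduce-P (u , w) (suc (suc first-hit)) (s≤s z≤n) eq j
      in before-return r r<P (trans (sym er) ej)
      where
      before-return : ∀ r → r < suc (suc first-hit) → iter r f' (u , w) ≢ (w , u)
      before-return zero _ e0 = uw (cong proj₁ e0)
      before-return (suc r) r<P er = isDeleted⇒¬adj w u (isDeleted-sym u w isDeleted-uw)
        (subst (λ y → T (adj₀ y)) (trans (sym (agree r (≤-pred (≤-pred r<P)))) er) (after-cw-edge r))

    touched-faces′-≥2 : 2 ≤ countPairs (λ d → rep'B d ∧ touched d)
    touched-faces′-≥2 =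
      let (m1 , rm1 , tm1) = rep-of-uw
          (m2 , rm2 , o2) = O'.rep-exists (w , u) e'
          tm2 = new-touched m2 (w , u) (O'.orb-sym (w , u) m2 e' o2) (isDeleted⇒¬adj w u (isDeleted-sym u w isDeleted-uw)) (O'.rep-valid m2 rm2)
          o1 = proj₂ (proj₂ (O'.rep-exists (u , w) e))
      in countPairs-≥2 _ m1 m2 (λ eq → uw-and-wu-on-different-faces
             (O'.orb-trans o1 (O'.orb-trans (subst (λ y → O'.Orb y (w , u)) (sym eq) (O'.orb-sym (w , u) m2 e' o2)) (0 , refl))))
           (T-∧-intro {rep'B m1} rm1 tm1) (T-∧-intro {rep'B m2} rm2 tm2)

    sameFace-faces : dartFaces G₀ R₀ + 1 ≤ dartFaces G R'
    sameFace-faces = subst₂ (λ a b → a + 1 ≤ b) (sym (countPairs-split rep₀B touched)) (sym (countPairs-split rep'B touched))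
      (sameFace-faces-arithmetic _ _ _ _ touched-faces₀-≤1 untouched-bound touched-faces′-≥2)

    isolated-≤ : isolated G₀ ≤ isolated G
    isolated-≤ = ≤-trans isolated-deleteEdge (≤-reflexive (trans
      (cong₂ (λ a b → isolated G + a + b) (indicator-partner-zero (corner-or-isolated u p cp) cu-edge)
                                          (indicator-partner-zero (corner-or-isolated w q cq) cw-edge))
      (trans (+-identityʳ _) (+-identityʳ _))))
      where
      indicator-partner-zero : ∀ {a b} → indicator a + indicator b ≡ 1 → T a → indicator b ≡ 0
      indicator-partner-zero {true} {false} _ _ = refl
      indicator-partner-zero {true} {true} () _

    sameFace-genus : ∀ j → GenusLe G₀ R₀ j → GenusLe G R' j
    sameFace-genus j h = sameFace-genus-arithmetic (components G) (components G₀) (edges G) (edges G₀) j (n G)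
      (dartFaces G₀ R₀) (isolated G₀) (dartFaces G R') (isolated G)
      components-deleteEdge edges-deleteEdge h sameFace-faces isolated-≤

-- Embeddings

EmbedsIn-mono : ∀ H j j' → j ≤ j' → EmbedsIn H j → EmbedsIn H j'
EmbedsIn-mono H j j' le (R , h) = R , ≤-trans h (+-monoˡ-≤ (faces H R) (+-monoˡ-≤ (n H) (*-monoʳ-≤ 2 le)))

edgeless-EmbedsIn-0 : ∀ H → (∀ a b → ¬ T (adj H a b)) → EmbedsIn H 0
edgeless-EmbedsIn-0 H none = R , goal
  where
  R : Rotation H
  R = record { ρ = λ a b → b ; ρ-nbr = λ u v h → ⊥-elim (none u v h) ; ρ-inj = λ u v w h _ _ → ⊥-elim (none u v h)
             ; ρ-cyc = λ u v w h _ → ⊥-elim (none u v h) }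
  E0 : edges H ≡ 0
  E0 = PairCount.countPairs-≡0 (n H) _ (λ d t → none _ _ (T-∧ʳ {toℕ (proj₁ d) <ᵇ toℕ (proj₂ d)} t))
  I : isolated H ≡ n H
  I = count-≡n (n H) _ (λ a → T-not-intro (λ t → let (b , tb) = anyF⇒∃ (n H) _ t in none a b tb))
  goal : 2 * components H + edges H ≤ 2 * 0 + n H + faces H R
  goal rewrite E0 | I = begin
    2 * components H + 0 ≡⟨ +-identityʳ _ ⟩
    2 * components H ≤⟨ *-monoʳ-≤ 2 (count-≤n (n H) _) ⟩
    2 * n H ≡⟨ cong (n H +_) (+-identityʳ (n H)) ⟩
    n H + n H ≤⟨ +-monoʳ-≤ (n H) (m≤n+m (n H) (dartFaces H R)) ⟩
    n H + (dartFaces H R + n H) ∎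
    where open ≤-Reasoning

adj⇒≢ : ∀ H a b → T (adj H a b) → a ≢ b
adj⇒≢ H a b h refl = subst T (adj-irr H a) h

neighbourOr : ∀ (H : Graph) (c o : Fin (n H)) → Σ (Fin (n H)) λ p → T (adj H c p) ⊎ (p ≡ o × (∀ z → ¬ T (adj H c z)))
neighbourOr H c o = T-case (anyF (n H) (λ v → adj H c v))
  (λ t → let (p , tp) = anyF⇒∃ (n H) _ t in p , inj₁ tp)
  (λ nt → o , inj₂ (refl , λ z tz → nt (T⇒anyF (n H) _ z tz)))

EmbedsIn-insertEdge : ∀ (Γ : Graph) u w → T (adj Γ u w) → ∀ j → EmbedsIn (deleteEdge Γ u w) j → EmbedsIn Γ (suc j)
EmbedsIn-insertEdge Γ u w e j (R₀ , h) =
  let (p , cp) = neighbourOr (deleteEdge Γ u w) u w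
      (q , cq) = neighbourOr (deleteEdge Γ u w) w u
      open EdgeInsertion Γ u w (adj⇒≢ Γ u w e) e R₀ p q cp cq
  in R' , insertion-genus j h

EmbedsIn-insertEdge-commonFace : ∀ (Γ : Graph) u w → Edge Γ u w → (R₀ : Rotation (deleteEdge Γ u w))
  → ∀ j → GenusLe (deleteEdge Γ u w) R₀ j
  → ∀ c₁ c₂ → Edge (deleteEdge Γ u w) (proj₁ c₁) (proj₂ c₁) → Edge (deleteEdge Γ u w) (proj₁ c₂) (proj₂ c₂)
  → proj₂ c₁ ≡ u → proj₂ c₂ ≡ w → FaceOrbits.Orb (deleteEdge Γ u w) R₀ c₁ c₂ → EmbedsIn Γ j
EmbedsIn-insertEdge-commonFace Γ u w e R₀ j genus (p , .u) (q , .w) vp vq refl refl o = R' , sameFace-genus j genus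
  where
  hp = subst T (adj-sym (deleteEdge Γ u w) p u) vp
  hq = subst T (adj-sym (deleteEdge Γ u w) q w) vq
  open EdgeInsertion Γ u w (adj⇒≢ Γ u w e) e R₀ p q (inj₁ hp) (inj₁ hq)
  open SameFace hp hq o

graph-tcontract : ∀ m r (u v : Fin m) ne x y → graph (tcontract′ m r u v ne x y) ≡ contract′ m r u v ne
graph-tcontract zero r () v ne x y
graph-tcontract (suc m) r u v ne x y = refl

HasGenus-suc : ∀ H k → EmbedsIn H (suc k) → ¬ EmbedsIn H k → HasGenus H (suc k)
HasGenus-suc H k emb ¬emb = emb , λ j j<sk embⱼ → ¬emb (EmbedsIn-mono H j k (≤-pred j<sk) embⱼ)

¬EmbedsIn⇒edge : ∀ H j → ¬ EmbedsIn H j → ∃ λ a → ∃ λ b → Edge H a b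
¬EmbedsIn⇒edge H j ¬emb = T-case (anyF (n H) (λ a → anyF (n H) (λ b → adj H a b)))
  (λ t → let (a , ta) = anyF⇒∃ (n H) _ t ; (b , tb) = anyF⇒∃ (n H) _ ta in a , b , tb)
  (λ nt → ⊥-elim (¬emb (EmbedsIn-mono H 0 j z≤n
    (edgeless-EmbedsIn-0 H (λ a b t → nt (T⇒anyF (n H) _ a (T⇒anyF (n H) _ b t)))))))

-- Alternating faces

record AlternatingFaceAtX (H : Graph) (R : Rotation H) (x y : Fin (n H)) : Set where
  field
    d        : Dart H
    d-edge   : Edge H (proj₁ d) (proj₂ d)
    l        : ℕ
    period   : iter l (faceMap H R) d ≡ d
    minimal  : ∀ j → 0 < j → j < l → iter j (faceMap H R) d ≢ d
    j₂ j₃ j₄ : ℕ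
    0<j₂     : 0 < j₂
    j₂<j₃    : j₂ < j₃
    j₃<j₄    : j₃ < j₄
    j₄<l     : j₄ < l
    x-at-0   : proj₁ d ≡ x
    y-at-j₂  : proj₁ (iter j₂ (faceMap H R) d) ≡ y
    x-at-j₃  : proj₁ (iter j₃ (faceMap H R) d) ≡ x
    y-at-j₄  : proj₁ (iter j₄ (faceMap H R) d) ≡ y

  0<l : 0 < l
  0<l = <-trans (<-trans 0<j₂ (<-trans j₂<j₃ j₃<j₄)) j₄<l

AlternatingFaceAtX⇒FaceAlternates : ∀ {H R x y} → AlternatingFaceAtX H R x y → FaceAlternates H R x y
AlternatingFaceAtX⇒FaceAlternates A = d , d-edge , l , 0<l , period , minimal , 0 , j₂ , j₃ , j₄
  , 0<j₂ , j₂<j₃ , j₃<j₄ , j₄<l , x-at-0 , y-at-j₂ , x-at-j₃ , y-at-j₄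
  where open AlternatingFaceAtX A

FaceAlternates⇒AlternatingFaceAtX : ∀ {H R x y} → FaceAlternates H R x y → AlternatingFaceAtX H R x y
FaceAlternates⇒AlternatingFaceAtX {H} {R}
  (d , ed , l , _ , per , minp , i₁ , i₂ , i₃ , i₄ , i₁<i₂ , i₂<i₃ , i₃<i₄ , i₄<l , x₁ , y₂ , x₃ , y₄) = record
  { d = iter i₁ f d ; d-edge = O.iter-valid i₁ d ed ; l = l
  ; period = trans (iter-comm f l i₁ d) (cong (iter i₁ f) per)
  ; minimal = λ j 0<j j<l eq → minp j 0<j j<l
      (O.iter-inj i₁ _ _ (O.iter-valid j d ed) ed (trans (sym (iter-comm f j i₁ d)) eq))
  ; j₂ = i₂ ∸ i₁ ; j₃ = i₃ ∸ i₁ ; j₄ = i₄ ∸ i₁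
  ; 0<j₂ = m<n⇒0<n∸m i₁<i₂
  ; j₂<j₃ = ∸-monoˡ-< i₂<i₃ (<⇒≤ i₁<i₂)
  ; j₃<j₄ = ∸-monoˡ-< i₃<i₄ (<⇒≤ i₁<i₃)
  ; j₄<l = ≤-<-trans (m∸n≤m i₄ i₁) i₄<l
  ; x-at-0 = x₁
  ; y-at-j₂ = trans (head-at i₂ (<⇒≤ i₁<i₂)) y₂
  ; x-at-j₃ = trans (head-at i₃ (<⇒≤ i₁<i₃)) x₃
  ; y-at-j₄ = trans (head-at i₄ (<⇒≤ (<-trans i₁<i₃ i₃<i₄))) y₄ }
  where
  module O = FaceOrbits H R
  f = faceMap H R
  i₁<i₃ = <-trans i₁<i₂ i₂<i₃
  head-at : ∀ i → i₁ ≤ i → proj₁ (iter (i ∸ i₁) f (iter i₁ f d)) ≡ proj₁ (iter i f d)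
  head-at i i₁≤i = cong proj₁ (trans (sym (iter-add f (i ∸ i₁) i₁ d)) (cong (λ k → iter k f d) (m∸n+n≡m i₁≤i)))

alternatingFace-insertEdge-EmbedsIn : ∀ (Γ : Graph) {x y} (e : Edge Γ x y) (R₀ : Rotation (deleteEdge Γ x y)) j
  → GenusLe (deleteEdge Γ x y) R₀ j → AlternatingFaceAtX (deleteEdge Γ x y) R₀ x y → EmbedsIn Γ j
alternatingFace-insertEdge-EmbedsIn Γ {x} {y} e R₀ j genus A =
  EmbedsIn-insertEdge-commonFace Γ x y e R₀ j genus into-x into-y
    (O.iter-valid (pred l) d d-edge) (O.iter-valid (pred j₂) d d-edge)
    (trans (cong proj₁ (iter-pred f l 0<l d)) (trans (cong proj₁ period) x-at-0))
    (trans (cong proj₁ (iter-pred f j₂ 0<j₂ d)) y-at-j₂)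
    (suc (pred j₂) , trans (iter-suc f (pred j₂) into-x) (cong (iter (pred j₂) f) (trans (iter-pred f l 0<l d) period)))
  where
  open AlternatingFaceAtX A
  module O = FaceOrbits (deleteEdge Γ x y) R₀
  f = faceMap (deleteEdge Γ x y) R₀
  into-x = iter (pred l) f d
  into-y = iter (pred j₂) f d

module AlternatingInsertion (Γ : Graph) {x y z : Fin (n Γ)} (e : Edge Γ x z)
  (R₀ : Rotation (deleteEdge Γ x z)) (j : ℕ) (genus₀ : GenusLe (deleteEdge Γ x z) R₀ j)
  (A : AlternatingFaceAtX (deleteEdge Γ x z) R₀ x y) (Γ↛ : ¬ EmbedsIn Γ j) where

  open AlternatingFaceAtX A
  G₀ = deleteEdge Γ x z
  module O₀ = FaceOrbits G₀ R₀
  f₀ = faceMap G₀ R₀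

  corner : Dart G₀
  corner = iter (pred l) f₀ d

  corner-next : f₀ corner ≡ d
  corner-next = trans (iter-pred f₀ l 0<l d) period

  corner-edge : Edge G₀ (proj₁ corner) (proj₂ corner)
  corner-edge = O₀.iter-valid (pred l) d d-edge

  p = proj₁ corner

  corner≡ : corner ≡ (p , x)
  corner≡ = cong (p ,_) (trans (cong proj₁ corner-next) x-at-0)

  z∉face : ∀ i → i < l → proj₂ (iter i f₀ d) ≢ z
  z∉face i _ z-at-i = Γ↛ (EmbedsIn-insertEdge-commonFace Γ x z e R₀ j genus₀ corner (iter i f₀ d)
    corner-edge (O₀.iter-valid i d d-edge) (cong proj₂ corner≡) z-at-i
    (suc i , trans (iter-suc f₀ i corner) (cong (iter i f₀) corner-next)))

  q = proj₁ (neighbourOr G₀ z x)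

  open EdgeInsertion Γ x z (adj⇒≢ Γ x z e) e R₀ p q
    (inj₁ (subst T (adj-sym G₀ p x) (subst (Edge G₀ p) (cong proj₂ corner≡) corner-edge)))
    (proj₂ (neighbourOr G₀ z x))
    using (R'; insertion-genus; f'; faceMap-off-corners; adj-deleteEdge⇒adj)
  module O' = FaceOrbits Γ R'

  agree : ∀ i → i < l → iter i f' d ≡ iter i f₀ d
  agree zero _ = refl
  agree (suc i) si<l = trans (cong f' (agree i i<l))
    (faceMap-off-corners (proj₁ dᵢ) (proj₂ dᵢ) (O₀.iter-valid i d d-edge) dᵢ≢corner (λ eq → z∉face i i<l (cong proj₂ eq)))
    where
    i<l = <-trans (n<1+n i) si<l
    dᵢ = iter i f₀ d
    dᵢ≢corner : dᵢ ≢ (p , x)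
    dᵢ≢corner eq = minimal (suc i) (s≤s z≤n) si<l (trans (cong f₀ (trans eq (sym corner≡))) corner-next)

  d-edge′ : Edge Γ (proj₁ d) (proj₂ d)
  d-edge′ = adj-deleteEdge⇒adj _ _ d-edge

  face′ = O'.face-length d d-edge′
  l′ = proj₁ face′
  0<l′ = proj₁ (proj₂ face′)
  period′ = proj₁ (proj₂ (proj₂ face′))
  minimal′ = proj₂ (proj₂ (proj₂ face′))

  l≤l′ : l ≤ l′
  l≤l′ = ≮⇒≥ λ l′<l → minimal l′ 0<l′ l′<l (trans (sym (agree l′ l′<l)) period′)

  head-agrees : ∀ i → i < l → proj₁ (iter i f' d) ≡ proj₁ (iter i f₀ d)
  head-agrees i i<l = cong proj₁ (agree i i<l)

  alternating : AlternatingFaceAtX Γ R' x y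
  alternating = record
    { d = d ; d-edge = d-edge′ ; l = l′
    ; period = period′ ; minimal = minimal′
    ; j₂ = j₂ ; j₃ = j₃ ; j₄ = j₄ ; 0<j₂ = 0<j₂ ; j₂<j₃ = j₂<j₃ ; j₃<j₄ = j₃<j₄
    ; j₄<l = <-≤-trans j₄<l l≤l′
    ; x-at-0 = x-at-0
    ; y-at-j₂ = trans (head-agrees j₂ (<-trans j₂<j₃ j₃<l)) y-at-j₂
    ; x-at-j₃ = trans (head-agrees j₃ j₃<l) x-at-j₃
    ; y-at-j₄ = trans (head-agrees j₄ j₄<l) y-at-j₄ }
    where j₃<l = <-trans j₃<j₄ j₄<l

  insertion : Σ (Rotation Γ) λ R → GenusLe Γ R (suc j) × AlternatingFaceAtX Γ R x y
  insertion = R' , insertion-genus j genus₀ , alternating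

Alternating-insertEdge : ∀ (G : TGraph) {z} → Edge (graph G) (x G) z → ∀ k → ¬ EmbedsIn (graph G) k
  → Alternating (tdelete G (x G) z) k → Alternating G (suc k)
Alternating-insertEdge G e k G↛ (_ , R₀ , genus₀ , face₀) =
  let (R , genus , A) = AlternatingInsertion.insertion (graph G) e R₀ k genus₀
                          (FaceAlternates⇒AlternatingFaceAtX face₀) G↛
  in HasGenus-suc (graph G) k (R , genus) G↛ , R , genus , AlternatingFaceAtX⇒FaceAlternates A

terminal-edge-EmbedsIn : ∀ (G : TGraph) k → Edge (graph G) (x G) (y G)
  → Alternating (tdelete G (x G) (y G)) k → EmbedsIn (graph G) k
terminal-edge-EmbedsIn G k e (_ , R₀ , genus₀ , face₀) =
  alternatingFace-insertEdge-EmbedsIn (graph G) e R₀ k genus₀ (FaceAlternates⇒AlternatingFaceAtX face₀)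

Alternating-deletion⇒x-edge : ∀ (G : TGraph) {a b} k → Alternating (tdelete G a b) k
  → ∃ λ z → Edge (graph G) (x G) z
Alternating-deletion⇒x-edge G {a} {b} k (_ , R₀ , _ , face₀) =
  proj₂ d , Deletion.adj-deleteEdge⇒adj (graph G) a b _ _ (subst (λ v → Edge (deleteEdge (graph G) a b) v (proj₂ d)) x-at-0 d-edge)
  where open AlternatingFaceAtX (FaceAlternates⇒AlternatingFaceAtX {deleteEdge (graph G) a b} {R₀} {x G} {y G} face₀)

𝒜⇒EmbedsIn : ∀ (G : TGraph) k → 𝒜 G (suc k) → EmbedsIn (graph G) (suc k)
𝒜⇒EmbedsIn G k (inj₁ emb) = EmbedsIn-mono (graph G) k (suc k) (n≤1+n k) emb
𝒜⇒EmbedsIn G k (inj₂ ((emb , _) , _)) = emb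

tcontract-𝒜⇒EmbedsIn : ∀ (G : TGraph) k u v (u≢v : u ≢ v) → 𝒜 (tcontract G u v u≢v) (suc k)
  → EmbedsIn (contractEdge (graph G) u v u≢v) (suc k)
tcontract-𝒜⇒EmbedsIn G k u v u≢v contraction∈𝒜 =
  subst (λ H → EmbedsIn H (suc k)) (graph-tcontract (n (graph G)) (adj (graph G)) u v u≢v (x G) (y G))
    (𝒜⇒EmbedsIn (tcontract G u v u≢v) k contraction∈𝒜)

𝒜-deletion⇒Alternating : ∀ (G : TGraph) k u v → Edge (graph G) u v → ¬ EmbedsIn (graph G) (suc k)
  → 𝒜 (tdelete G u v) (suc k) → Alternating (tdelete G u v) (suc k)
𝒜-deletion⇒Alternating G k u v e G↛ (inj₁ emb) = ⊥-elim (G↛ (EmbedsIn-insertEdge (graph G) u v e k emb))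
𝒜-deletion⇒Alternating G k u v e G↛ (inj₂ alt) = alt

¬adj⇒¬JoinsTerminals : ∀ (G : TGraph) {u v} → adj (graph G) (x G) (y G) ≡ false → Edge (graph G) u v
  → ¬ JoinsTerminals G u v
¬adj⇒¬JoinsTerminals G ¬xy e (inj₁ (refl , refl)) = subst T ¬xy e
¬adj⇒¬JoinsTerminals G ¬xy e (inj₂ (refl , refl)) = subst T (trans (adj-sym (graph G) (y G) (x G)) ¬xy) e

lemma10 : (k : ℕ) → 1 ≤ k → (G : TGraph) → x G ≢ y G → ℱ G k
  → ¬ EmbedsIn (graph G) k
  → (adj (graph G) (x G) (y G) ≡ false)
  × Alternating G (suc k)
  × Obstruction (graph G) k
lemma10 (suc k) _ G _ (_ , deletion∈𝒜 , contraction∈𝒜) G↛ =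
  ¬adj-xy , Alternating-insertEdge G (proj₂ x-edge) (suc k) G↛ (deletion-alternating _ _ (proj₂ x-edge)) ,
  G↛ , deletion-embeds , contraction-embeds
  where
  deletion-alternating : ∀ u v → Edge (graph G) u v → Alternating (tdelete G u v) (suc k)
  deletion-alternating u v e = 𝒜-deletion⇒Alternating G k u v e G↛ (deletion∈𝒜 u v e)

  ¬adj-xy : adj (graph G) (x G) (y G) ≡ false
  ¬adj-xy = ¬T⇒≡false λ e → G↛ (terminal-edge-EmbedsIn G (suc k) e (deletion-alternating _ _ e))

  x-edge : ∃ λ z → Edge (graph G) (x G) z
  x-edge = let (a , b , e) = ¬EmbedsIn⇒edge (graph G) (suc k) G↛
           in Alternating-deletion⇒x-edge G (suc k) (deletion-alternating a b e)

  deletion-embeds : ∀ u v → Edge (graph G) u v → EmbedsIn (deleteEdge (graph G) u v) (suc k)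
  deletion-embeds u v e = 𝒜⇒EmbedsIn (tdelete G u v) k (deletion∈𝒜 u v e)

  contraction-embeds : ∀ u v → Edge (graph G) u v → (u≢v : u ≢ v) → EmbedsIn (contractEdge (graph G) u v u≢v) (suc k)
  contraction-embeds u v e u≢v =
    tcontract-𝒜⇒EmbedsIn G k u v u≢v (contraction∈𝒜 u v e (¬adj⇒¬JoinsTerminals G ¬adj-xy e) u≢v)
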